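{- There is a computable graph $G$ with a computable tracing function and no chordless 4-paths such that $0'$ is computable from any embedding of $A$ into $G$ and from any embedding of $K_{\omega,\omega}$ into $G$.
   Context: A graph is a pair $G=(V,E)$ with $V\subseteq\mathbb{N}$ and $E$ a symmetric irreflexive binary relation on $V$. An $n$-path is a sequence of distinct vertices $v_0,\dots,v_{n-1}$ with $E(v_i,v_{i+1})$ for all $i\le n-2$; it is chordless if $E(v_i,v_j)$ holds if and only if $|i-j|=1$. A tracing function for an infinite graph is a bijection $T:\mathbb{N}\to V$ with $E(T(i),T(i+1))$ for all $i$. $K_{\omega,\omega}$ is the graph with vertices $a_n,b_n$ ($n\in\mathbb{N}$) and edges between $a_n$ and $b_m$ for all $n,m$. $A$ is the graph with vertices $a_n,b_n$ ($n\in\mathbb{N}$) and edges between $a_n$ and $b_m$ exactly when $n\le m$. An embedding of $H$ into $G$ is an injective function $g:V_H\to V_G$ such that whenever $x,y$ are adjacent in $H$, $g(x),g(y)$ are adjacent in $G$ (additional edges in $G$ are allowed). $0'$ is the halting problem. -}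

module Defs where

open import Data.Nat using (ℕ; zero; suc; _+_; _*_; _^_; _≤_)
open import Data.Fin using (Fin; toℕ)
open import Data.Vec using (Vec; []; _∷_; lookup)
open import Data.Product using (Σ; ∃; _×_; _,_)
open import Data.Sum using (_⊎_)
open import Relation.Nullary using (¬_)
open import Relation.Binary.PropositionalEquality using (_≡_)

data Code : ℕ → Set where
  zer  : ∀ {k} → Code k
  succ : Code 1
  proj : ∀ {k} → Fin k → Code k
  orc  : Code 1
  comp : ∀ {k m} → Code m → Vec (Code k) m → Code k
  prec : ∀ {k} → Code k → Code (suc (suc k)) → Code (suc k)
  mu   : ∀ {k} → Code (suc k) → Code k

mutual
  data Eval (f : ℕ → ℕ) : ∀ {k} → Code k → Vec ℕ k → ℕ → Set where
    e-zer  : ∀ {k} {xs : Vec ℕ k} → Eval f zer xs 0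
    e-succ : ∀ {x} → Eval f succ (x ∷ []) (suc x)
    e-proj : ∀ {k} {i : Fin k} {xs} → Eval f (proj i) xs (lookup xs i)
    e-orc  : ∀ {x} → Eval f orc (x ∷ []) (f x)
    e-comp : ∀ {k m} {c : Code m} {cs : Vec (Code k) m} {xs ys y} →
             EvalVec f cs xs ys → Eval f c ys y → Eval f (comp c cs) xs y
    e-prec0 : ∀ {k} {g : Code k} {h} {xs y} →
             Eval f g xs y → Eval f (prec g h) (0 ∷ xs) y
    e-precS : ∀ {k} {g : Code k} {h} {n xs r y} →
             Eval f (prec g h) (n ∷ xs) r → Eval f h (n ∷ r ∷ xs) y →
             Eval f (prec g h) (suc n ∷ xs) y
    e-mu   : ∀ {k} {c : Code (suc k)} {xs y} →
             Search f c xs 0 y → Eval f (mu c) xs y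

  data EvalVec (f : ℕ → ℕ) {k} : ∀ {m} → Vec (Code k) m → Vec ℕ k → Vec ℕ m → Set where
    ev-[] : ∀ {xs} → EvalVec f [] xs []
    ev-∷  : ∀ {m c} {cs : Vec (Code k) m} {xs y ys} →
            Eval f c xs y → EvalVec f cs xs ys → EvalVec f (c ∷ cs) xs (y ∷ ys)

  data Search (f : ℕ → ℕ) {k} (c : Code (suc k)) (xs : Vec ℕ k) : ℕ → ℕ → Set where
    s-here : ∀ {i} → Eval f c (i ∷ xs) 0 → Search f c xs i i
    s-next : ∀ {i m y} → Eval f c (i ∷ xs) (suc m) → Search f c xs (suc i) y →
             Search f c xs i y

⟨_,_⟩ : ℕ → ℕ → ℕ
⟨ a , b ⟩ = 2 ^ a * (2 * b + 1)

mutual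
  ⌜_⌝ : ∀ {k} → Code k → ℕ
  ⌜ zer {k} ⌝ = ⟨ 0 , k ⟩
  ⌜ succ ⌝ = ⟨ 1 , 0 ⟩
  ⌜ proj {k} i ⌝ = ⟨ 2 , ⟨ k , toℕ i ⟩ ⟩
  ⌜ orc ⌝ = ⟨ 3 , 0 ⟩
  ⌜ comp {k} {m} c cs ⌝ = ⟨ 4 , ⟨ k , ⟨ m , ⟨ ⌜ c ⌝ , ⌜ cs ⌝v ⟩ ⟩ ⟩ ⟩
  ⌜ prec {k} g h ⌝ = ⟨ 5 , ⟨ k , ⟨ ⌜ g ⌝ , ⌜ h ⌝ ⟩ ⟩ ⟩
  ⌜ mu {k} c ⌝ = ⟨ 6 , ⟨ k , ⌜ c ⌝ ⟩ ⟩

  ⌜_⌝v : ∀ {k m} → Vec (Code k) m → ℕ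
  ⌜ [] ⌝v = 0
  ⌜ c ∷ cs ⌝v = ⟨ ⌜ c ⌝ , ⌜ cs ⌝v ⟩

-- Unrelativised computation = computation relative to the empty oracle.

noOracle : ℕ → ℕ
noOracle _ = 0

Halting : ℕ → Set
Halting n = Σ (Code 1) λ c → ⌜ c ⌝ ≡ n × ∃ λ y → Eval noOracle c (n ∷ []) y

ComputableFrom : (ℕ → ℕ) → (ℕ → Set) → Set
ComputableFrom f P = Σ (Code 1) λ c → ∀ n →
  (P n × Eval f c (n ∷ []) 1) ⊎ (¬ P n × Eval f c (n ∷ []) 0)

ComputableRel : (ℕ → ℕ → Set) → Set
ComputableRel R = Σ (Code 2) λ c → ∀ n m →
  (R n m × Eval noOracle c (n ∷ m ∷ []) 1) ⊎ (¬ R n m × Eval noOracle c (n ∷ m ∷ []) 0)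

ComputableFun : (ℕ → ℕ) → Set
ComputableFun T = Σ (Code 1) λ c → ∀ n → Eval noOracle c (n ∷ []) (T n)

record Graph : Set₁ where
  field
    V      : ℕ → Set
    E      : ℕ → ℕ → Set
    E-sym  : ∀ {x y} → E x y → E y x
    E-irr  : ∀ {x} → ¬ E x x
    E-V    : ∀ {x y} → E x y → V x × V y
open Graph public

ComputableGraph : Graph → Set
ComputableGraph G = ComputableFrom noOracle (V G) × ComputableRel (E G)

IsTracing : Graph → (ℕ → ℕ) → Set
IsTracing G T =
  (∀ i → V G (T i)) ×
  (∀ i j → T i ≡ T j → i ≡ j) ×
  (∀ v → V G v → ∃ λ i → T i ≡ v) ×
  (∀ i → E G (T i) (T (suc i)))

ChordlessFourPath : Graph → Set
ChordlessFourPath G = Σ ℕ λ v0 → Σ ℕ λ v1 → Σ ℕ λ v2 → Σ ℕ λ v3 →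
  ¬ v0 ≡ v1 × ¬ v0 ≡ v2 × ¬ v0 ≡ v3 × ¬ v1 ≡ v2 × ¬ v1 ≡ v3 × ¬ v2 ≡ v3 ×
  E G v0 v1 × E G v1 v2 × E G v2 v3 ×
  ¬ E G v0 v2 × ¬ E G v1 v3 × ¬ E G v0 v3

-- Embedding (not necessarily induced) of H into G.
record Embedding (H G : Graph) : Set where
  field
    emb      : ℕ → ℕ
    emb-V    : ∀ {x} → V H x → V G (emb x)
    emb-inj  : ∀ {x y} → V H x → V H y → emb x ≡ emb y → x ≡ y
    emb-E    : ∀ {x y} → E H x y → E G (emb x) (emb y)
open Embedding public

a : ℕ → ℕ
a n = 2 * n

b : ℕ → ℕ
b n = suc (2 * n)

data KE : ℕ → ℕ → Set where
  ab : ∀ n m → KE (a n) (b m)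
  ba : ∀ n m → KE (b m) (a n)

data AE : ℕ → ℕ → Set where
  ab : ∀ n m → n ≤ m → AE (a n) (b m)
  ba : ∀ n m → n ≤ m → AE (b m) (a n)


private
  open import Data.Unit using (⊤; tt)
  open import Data.Nat.Properties using (+-suc)
  open import Relation.Binary.PropositionalEquality using (cong; trans; sym)
  open import Data.Nat using (pred)

  dbl : ∀ n → 2 * suc n ≡ suc (suc (2 * n))
  dbl n = cong suc (+-suc n (n + 0))

  even≢odd : ∀ n m → ¬ (2 * n ≡ suc (2 * m))
  even≢odd zero m ()
  even≢odd (suc n) zero e with trans (sym (dbl n)) e
  ... | ()
  even≢odd (suc n) (suc m) e =
    even≢odd n m (cong pred (cong pred (trans (sym (dbl n)) (trans e (cong suc (dbl m))))))

  KE-sym : ∀ {x y} → KE x y → KE y x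
  KE-sym (ab n m) = ba n m
  KE-sym (ba n m) = ab n m

  KE-irr : ∀ {x} → ¬ KE x x
  KE-irr {x} e = go e refl'
    where
    refl' : x ≡ x
    refl' = Relation.Binary.PropositionalEquality.refl
    go : ∀ {y z} → KE y z → ¬ (y ≡ z)
    go (ab n m) = even≢odd n m
    go (ba n m) q = even≢odd n m (sym q)

  AE-sym : ∀ {x y} → AE x y → AE y x
  AE-sym (ab n m p) = ba n m p
  AE-sym (ba n m p) = ab n m p

  AE-irr : ∀ {x} → ¬ AE x x
  AE-irr {x} e = go e Relation.Binary.PropositionalEquality.refl
    where
    go : ∀ {y z} → AE y z → ¬ (y ≡ z)
    go (ab n m _) = even≢odd n m
    go (ba n m _) q = even≢odd n m (sym q)

Kωω : Graph
Kωω = record { V = λ _ → ⊤ ; E = KE ; E-sym = KE-sym ; E-irr = KE-irr ; E-V = λ _ → tt , tt }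

Agraph : Graph
Agraph = record { V = λ _ → ⊤ ; E = AE ; E-sym = AE-sym ; E-irr = AE-irr ; E-V = λ _ → tt , tt }

-- The vertices are the stages of an enumeration of the halting problem. Let κ t be the least
-- program halting exactly at stage t (or t if there is none), and call s alive at stage t if no
-- program e ≤ κ s halts between stages s and t; s dies at the first stage where it is not.
-- Two stages are adjacent when one is an ancestor of the other: t is born while s is alive, or
-- t is reached from s by a chain of successive deaths. The ancestors of a vertex are linearly
-- ordered, so the graph is the comparability graph of a forest and has no induced P₄, and
-- consecutive stages are adjacent, so the identity traces it. If f embeds A (or K_{ω,ω}), each
-- f(a_n) is adjacent to the infinitely many f(b_m) with m ≥ n, while a dying vertex has only
-- finitely many neighbours; so every f(a_n) lives forever. By pigeonhole some f(a_j) with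
-- j ≤ 2e has κ ≥ e, and then e halts iff it halts by stage f(a_j), which f lets us compute.
--
-- That "e halts by stage s" is decidable comes from a Kleene normal form: halting is witnessed
-- by a coded list of judgments, each an instance of one of finitely many rules whose premises
-- occur later in the list, and checking such a certificate is a bounded arithmetic formula.
module Submission where

open import Defs
open import Data.Nat using (ℕ; zero; suc; _+_; _*_; _∸_; _^_; _≤_; _<_; z≤n; s≤s; pred; _<?_; _≤?_; _≟_; >-nonZero)
open import Data.Nat.Properties
open import Data.Nat.Induction using (<-rec)
open import Data.Fin using (Fin; zero; suc; toℕ; fromℕ<; _↑ˡ_; _↑ʳ_)
open import Data.Fin.Properties using (toℕ<n; toℕ-fromℕ<; toℕ-injective; pigeonhole) renaming (_≟_ to _≟ᶠ_)
open import Data.Vec using (Vec; []; _∷_; lookup; tabulate; head; tail) renaming (_++_ to _++ᵥ_)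
open import Data.Vec.Properties using (tabulate∘lookup; tabulate-cong; lookup-++ˡ; lookup-++ʳ)
open import Data.List using (List; []; _∷_; _++_; drop; length)
open import Data.List.Relation.Unary.All as All using (All; []; _∷_)
open import Data.Bool using (Bool; true; false; T; _∨_; _∧_)
open import Data.Bool.Properties using (T-∨; T-∧)
open import Data.Product using (Σ; _×_; _,_; proj₁; proj₂; uncurry′)
open import Data.Sum using (_⊎_; inj₁; inj₂)
open import Data.Unit using (⊤; tt)
open import Data.Empty using (⊥; ⊥-elim)
open import Relation.Nullary using (¬_; Dec; yes; no; contradiction)
open import Relation.Binary using (Tri; tri<; tri≈; tri>)
open import Relation.Binary.PropositionalEquality
open import Function using (_∘_; id; Equivalence)
open import Relation.Nullary.Decidable using (toWitness; ⌊_⌋; decidable-stable; _×-dec_; ¬?)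

module Terms where

  recN : ℕ → (ℕ → ℕ → ℕ) → ℕ → ℕ
  recN z s zero = z
  recN z s (suc n) = s n (recN z s n)

  sumN : ℕ → (ℕ → ℕ) → ℕ
  sumN zero g = 0
  sumN (suc n) g = sumN n g + g n

  data Tm (k : ℕ) : Set where
    var : Fin k → Tm k
    lit : ℕ → Tm k
    _⊕_ _⊛_ _⊝_ : Tm k → Tm k → Tm k
    ⟪_,_⟫ : Tm k → Tm k → Tm k
    sub : ∀ {m} → Tm m → Vec (Tm k) m → Tm k
    rc : Tm k → Tm (suc (suc k)) → Tm k → Tm k
    sm : Tm k → Tm (suc k) → Tm k

  infixl 6 _⊕_ _⊝_
  infixl 7 _⊛_

  mutual
    ev : ∀ {k} → Tm k → Vec ℕ k → ℕ
    ev (var i) xs = lookup xs i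
    ev (lit n) xs = n
    ev (a ⊕ b) xs = ev a xs + ev b xs
    ev (a ⊛ b) xs = ev a xs * ev b xs
    ev (a ⊝ b) xs = ev a xs ∸ ev b xs
    ev ⟪ a , b ⟫ xs = ⟨ ev a xs , ev b xs ⟩
    ev (sub t ts) xs = ev t (evs ts xs)
    ev (rc g h n) xs = recN (ev g xs) (λ i r → ev h (i ∷ r ∷ xs)) (ev n xs)
    ev (sm n u) xs = sumN (ev n xs) (λ i → ev u (i ∷ xs))

    evs : ∀ {k m} → Vec (Tm k) m → Vec ℕ k → Vec ℕ m
    evs [] xs = []
    evs (t ∷ ts) xs = ev t xs ∷ evs ts xs

  module _ (f : ℕ → ℕ) where

    ComputableIn : ∀ k → (Vec ℕ k → ℕ) → Set
    ComputableIn k F = Σ (Code k) λ c → ∀ xs → Eval f c xs (F xs)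

    data AllComputableIn {k : ℕ} : ∀ {m} → Vec (Vec ℕ k → ℕ) m → Set where
      []  : AllComputableIn []
      _∷_ : ∀ {m F} {Fs : Vec (Vec ℕ k → ℕ) m} → ComputableIn k F → AllComputableIn Fs → AllComputableIn (F ∷ Fs)

    app : ∀ {k m} → Vec (Vec ℕ k → ℕ) m → Vec ℕ k → Vec ℕ m
    app [] xs = []
    app (F ∷ Fs) xs = F xs ∷ app Fs xs

    codesOf : ∀ {k m} {Fs : Vec (Vec ℕ k → ℕ) m} → AllComputableIn Fs → Vec (Code k) m
    codesOf [] = []
    codesOf (c ∷ cs) = proj₁ c ∷ codesOf cs

    evalsOf : ∀ {k m} {Fs : Vec (Vec ℕ k → ℕ) m} (cs : AllComputableIn Fs) xs →
              EvalVec f (codesOf cs) xs (app Fs xs)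
    evalsOf [] xs = ev-[]
    evalsOf (c ∷ cs) xs = ev-∷ (proj₂ c xs) (evalsOf cs xs)

    cf-comp : ∀ {k m G} {Fs : Vec (Vec ℕ k → ℕ) m} → ComputableIn m G → AllComputableIn Fs →
              ComputableIn k (λ xs → G (app Fs xs))
    cf-comp (g , eg) cs = comp g (codesOf cs) , λ xs → e-comp (evalsOf cs xs) (eg _)

    cf-ext : ∀ {k F G} → ComputableIn k F → (∀ xs → F xs ≡ G xs) → ComputableIn k G
    cf-ext (c , e) eq = c , λ xs → subst (Eval f c xs) (eq xs) (e xs)

    primrec : ∀ {k} → (Vec ℕ k → ℕ) → (Vec ℕ (suc (suc k)) → ℕ) → Vec ℕ (suc k) → ℕ
    primrec g h (zero ∷ xs) = g xs
    primrec g h (suc n ∷ xs) = h (n ∷ primrec g h (n ∷ xs) ∷ xs)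

    cf-prec : ∀ {k g h} → ComputableIn k g → ComputableIn (suc (suc k)) h → ComputableIn (suc k) (primrec g h)
    cf-prec {g = g} {h} (cg , eg) (ch , eh) = prec cg ch , go
      where
      go : ∀ xs → Eval f (prec cg ch) xs (primrec g h xs)
      go (zero ∷ xs) = e-prec0 (eg xs)
      go (suc n ∷ xs) = e-precS (go (n ∷ xs)) (eh _)

    cf-proj : ∀ {k} (i : Fin k) → ComputableIn k (λ xs → lookup xs i)
    cf-proj i = proj i , λ xs → e-proj

    cf-zero : ∀ {k} → ComputableIn k (λ _ → 0)
    cf-zero = zer , λ _ → e-zer

    cf-succ : ComputableIn 1 (λ xs → suc (head xs))
    cf-succ = succ , λ { (x ∷ []) → e-succ }

    cf-orc : ComputableIn 1 (λ xs → f (head xs))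
    cf-orc = orc , λ { (x ∷ []) → e-orc }

    cf-const : ∀ {k} n → ComputableIn k (λ _ → n)
    cf-const zero = cf-zero
    cf-const (suc n) = cf-comp cf-succ (cf-const n ∷ [])

    projs : ∀ {k m} → (Fin m → Fin k) → Vec (Vec ℕ k → ℕ) m
    projs {m = zero} ρ = []
    projs {m = suc m} ρ = (λ xs → lookup xs (ρ zero)) ∷ projs (ρ ∘ suc)

    cfs-projs : ∀ {k m} (ρ : Fin m → Fin k) → AllComputableIn (projs ρ)
    cfs-projs {m = zero} ρ = []
    cfs-projs {m = suc m} ρ = cf-proj (ρ zero) ∷ cfs-projs (ρ ∘ suc)

    app-projs : ∀ {k m} (ρ : Fin m → Fin k) xs → app (projs ρ) xs ≡ tabulate (λ i → lookup xs (ρ i))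
    app-projs {m = zero} ρ xs = refl
    app-projs {m = suc m} ρ xs = cong (_ ∷_) (app-projs (ρ ∘ suc) xs)

    app-id : ∀ {k} (xs : Vec ℕ k) → app (projs id) xs ≡ xs
    app-id xs = trans (app-projs id xs) (tabulate∘lookup xs)

    cf-let : ∀ {k N F} → ComputableIn k N → ComputableIn (suc k) F → ComputableIn k (λ xs → F (N xs ∷ xs))
    cf-let {N = N} {F} cN cF =
      cf-ext (cf-comp cF (cN ∷ cfs-projs id)) λ xs → cong (λ v → F (N xs ∷ v)) (app-id xs)

    cf-drop1 : ∀ {k F} → ComputableIn (suc k) F → ComputableIn (suc (suc k)) (λ v → F (head v ∷ tail (tail v)))
    cf-drop1 {F = F} cF =
      cf-ext (cf-comp cF (cf-proj zero ∷ cfs-projs (λ (i : Fin _) → suc (suc i))))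
        λ { (n ∷ r ∷ xs) → cong (λ v → F (n ∷ v)) (trans (app-projs (λ (i : Fin _) → suc (suc i)) (n ∷ r ∷ xs)) (tabulate∘lookup xs)) }

    cf2 : ∀ {k F G} (op : ℕ → ℕ → ℕ) → ComputableIn 2 (λ v → op (lookup v zero) (lookup v (suc zero))) →
          ComputableIn k F → ComputableIn k G → ComputableIn k (λ xs → op (F xs) (G xs))
    cf2 op cop cF cG = cf-comp cop (cF ∷ cG ∷ [])

    cf-add : ComputableIn 2 (λ v → lookup v zero + lookup v (suc zero))
    cf-add = cf-ext (cf-prec (cf-proj zero) (cf-comp cf-succ (cf-proj (suc zero) ∷ [])))
               λ { (n ∷ x ∷ []) → go n x }
      where
      go : ∀ n x → primrec (λ v → lookup v zero) (λ v → suc (lookup v (suc zero))) (n ∷ x ∷ []) ≡ n + x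
      go zero x = refl
      go (suc n) x = cong suc (go n x)

    cf-mul : ComputableIn 2 (λ v → lookup v zero * lookup v (suc zero))
    cf-mul = cf-ext (cf-prec cf-zero (cf2 _+_ cf-add (cf-proj (suc zero)) (cf-proj (suc (suc zero)))))
               λ { (n ∷ x ∷ []) → go n x }
      where
      go : ∀ n x → primrec (λ _ → 0) (λ v → lookup v (suc zero) + lookup v (suc (suc zero))) (n ∷ x ∷ []) ≡ n * x
      go zero x = refl
      go (suc n) x = trans (cong (_+ x) (go n x)) (+-comm (n * x) x)

    cf-pred : ComputableIn 1 (λ v → pred (head v))
    cf-pred = cf-ext (cf-prec cf-zero (cf-proj zero)) λ { (zero ∷ []) → refl ; (suc n ∷ []) → refl }

    ∸-suc : ∀ x y → x ∸ suc y ≡ pred (x ∸ y)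
    ∸-suc zero zero = refl
    ∸-suc zero (suc y) = refl
    ∸-suc (suc x) zero = refl
    ∸-suc (suc x) (suc y) = ∸-suc x y

    cf-mon : ComputableIn 2 (λ v → lookup v zero ∸ lookup v (suc zero))
    cf-mon = cf-ext (cf-comp (cf-prec (cf-proj zero) (cf-comp cf-pred (cf-proj (suc zero) ∷ [])))
                       (cf-proj (suc zero) ∷ cf-proj zero ∷ []))
               λ { (x ∷ y ∷ []) → go y x }
      where
      go : ∀ y x → primrec (λ v → lookup v zero) (λ v → pred (lookup v (suc zero))) (y ∷ x ∷ []) ≡ x ∸ y
      go zero x = refl
      go (suc y) x = trans (cong pred (go y x)) (sym (∸-suc x y))

    cf-pow : ComputableIn 1 (λ v → 2 ^ head v)
    cf-pow = cf-ext (cf-prec (cf-const 1) (cf2 _+_ cf-add (cf-proj (suc zero)) (cf-proj (suc zero))))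
               λ { (n ∷ []) → go n }
      where
      go : ∀ n → primrec (λ _ → 1) (λ v → lookup v (suc zero) + lookup v (suc zero)) (n ∷ []) ≡ 2 ^ n
      go zero = refl
      go (suc n) = trans (cong (λ z → z + z) (go n)) (cong (2 ^ n +_) (sym (+-identityʳ (2 ^ n))))

    cf-pair : ComputableIn 2 (λ v → ⟨ lookup v zero , lookup v (suc zero) ⟩)
    cf-pair = cf2 _*_ cf-mul (cf-comp cf-pow (cf-proj zero ∷ []))
                (cf2 _+_ cf-add (cf2 _*_ cf-mul (cf-const 2) (cf-proj (suc zero))) (cf-const 1))

    evF : ∀ {k m} → Vec (Tm k) m → Vec (Vec ℕ k → ℕ) m
    evF [] = []
    evF (t ∷ ts) = ev t ∷ evF ts

    app-evF : ∀ {k m} (ts : Vec (Tm k) m) xs → app (evF ts) xs ≡ evs ts xs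
    app-evF [] xs = refl
    app-evF (t ∷ ts) xs = cong (_ ∷_) (app-evF ts xs)

    recV-recN : ∀ {k} (g : Vec ℕ k → ℕ) h n xs → primrec g h (n ∷ xs) ≡ recN (g xs) (λ i r → h (i ∷ r ∷ xs)) n
    recV-recN g h zero xs = refl
    recV-recN g h (suc n) xs = cong (λ z → h (n ∷ z ∷ xs)) (recV-recN g h n xs)

    recV-sum : ∀ {k} (u : Vec ℕ (suc k) → ℕ) n xs →
      primrec (λ _ → 0) (λ v → lookup v (suc zero) + u (head v ∷ tail (tail v))) (n ∷ xs) ≡ sumN n (λ i → u (i ∷ xs))
    recV-sum u zero xs = refl
    recV-sum u (suc n) xs = cong (_+ u (n ∷ xs)) (recV-sum u n xs)

    mutual
      compile : ∀ {k} (t : Tm k) → ComputableIn k (ev t)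
      compile (var i) = cf-proj i
      compile (lit n) = cf-const n
      compile (a ⊕ b) = cf2 _+_ cf-add (compile a) (compile b)
      compile (a ⊛ b) = cf2 _*_ cf-mul (compile a) (compile b)
      compile (a ⊝ b) = cf2 _∸_ cf-mon (compile a) (compile b)
      compile ⟪ a , b ⟫ = cf2 ⟨_,_⟩ cf-pair (compile a) (compile b)
      compile (sub t ts) = cf-ext (cf-comp (compile t) (compiles ts)) λ xs → cong (ev t) (app-evF ts xs)
      compile (rc g h n) = cf-ext (cf-let (compile n) (cf-prec (compile g) (compile h)))
                             λ xs → recV-recN (ev g) (ev h) (ev n xs) xs
      compile (sm n u) = cf-ext (cf-let (compile n) (cf-prec cf-zero (cf2 _+_ cf-add (cf-proj (suc zero)) (cf-drop1 (compile u)))))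
                             λ xs → recV-sum (ev u) (ev n xs) xs

      compiles : ∀ {k m} (ts : Vec (Tm k) m) → AllComputableIn (evF ts)
      compiles [] = []
      compiles (t ∷ ts) = compile t ∷ compiles ts

module TruthTerms where

  open Terms

  Tr : ℕ → Set
  Tr x = 0 < x

  <-+1 : ∀ {m n} → m ≤ n → m < n + 1
  <-+1 {m} {n} h = subst (m <_) (+-comm 1 n) (s≤s h)

  Tr? : ∀ x → Dec (Tr x)
  Tr? x = 0 <? x

  ¬Tr⇒0 : ∀ {x} → ¬ Tr x → x ≡ 0
  ¬Tr⇒0 {zero} _ = refl
  ¬Tr⇒0 {suc x} h = ⊥-elim (h (s≤s z≤n))

  wk : ∀ {k} → Tm k → Tm (suc k)
  wk t = sub t (tabulate (λ i → var (suc i)))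

  wk1 : ∀ {k} → Tm (suc k) → Tm (suc (suc k))
  wk1 t = sub t (var zero ∷ tabulate (λ i → var (suc (suc i))))

  eqT ltT andT orT impT : ∀ {k} → Tm k → Tm k → Tm k
  eqT a b = lit 1 ⊝ ((a ⊝ b) ⊕ (b ⊝ a))
  ltT a b = b ⊝ a
  andT a b = a ⊛ b
  orT a b = a ⊕ b
  impT a b = (lit 1 ⊝ a) ⊕ b

  negT sgT : ∀ {k} → Tm k → Tm k
  negT a = lit 1 ⊝ a
  sgT a = lit 1 ⊝ (lit 1 ⊝ a)

  -- muT n φ counts the j < n for which no i ≤ j satisfies φ, i.e. it is the least witness below n (or n).
  exT allT muT : ∀ {k} → Tm k → Tm (suc k) → Tm k
  exT n φ = sm n φ
  allT n φ = lit 1 ⊝ sm n (lit 1 ⊝ φ)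
  muT n φ = sm n (lit 1 ⊝ sm (lit 1 ⊕ var zero) (wk1 φ))

  evs-tab : ∀ {k m} (g : Fin m → Fin k) xs → evs (tabulate (λ i → var (g i))) xs ≡ tabulate (λ i → lookup xs (g i))
  evs-tab {m = zero} g xs = refl
  evs-tab {m = suc m} g xs = cong (lookup xs (g zero) ∷_) (evs-tab (λ i → g (suc i)) xs)

  ev-wk : ∀ {k} (t : Tm k) x xs → ev (wk t) (x ∷ xs) ≡ ev t xs
  ev-wk t x xs = cong (ev t) (trans (evs-tab suc (x ∷ xs)) (tabulate∘lookup xs))

  ev-wk1 : ∀ {k} (t : Tm (suc k)) i j xs → ev (wk1 t) (i ∷ j ∷ xs) ≡ ev t (i ∷ xs)
  ev-wk1 t i j xs = cong (λ v → ev t (i ∷ v)) (trans (evs-tab (λ l → suc (suc l)) (i ∷ j ∷ xs)) (tabulate∘lookup xs))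

  embedˡ : ∀ {k} m → Vec (Tm (k + m)) k
  embedˡ m = tabulate (λ i → var (i ↑ˡ m))

  evs-embedˡ : ∀ {k m} (ws : Vec ℕ k) (xs : Vec ℕ m) → evs (embedˡ m) (ws ++ᵥ xs) ≡ ws
  evs-embedˡ {m = m} ws xs = begin
    evs (embedˡ m) (ws ++ᵥ xs)                 ≡⟨ evs-tab (_↑ˡ m) (ws ++ᵥ xs) ⟩
    tabulate (λ i → lookup (ws ++ᵥ xs) (i ↑ˡ m)) ≡⟨ tabulate-cong (lookup-++ˡ ws xs) ⟩
    tabulate (lookup ws)                       ≡⟨ tabulate∘lookup ws ⟩
    ws                                         ∎
    where open ≡-Reasoning

  weakenʳ : ∀ {k} n → Tm k → Tm (n + k)
  weakenʳ n t = sub t (tabulate (λ i → var (n ↑ʳ i)))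

  ev-weakenʳ : ∀ {k} n (t : Tm k) (ws : Vec ℕ n) xs → ev (weakenʳ n t) (ws ++ᵥ xs) ≡ ev t xs
  ev-weakenʳ n t ws xs = cong (ev t) (begin
    evs (tabulate (λ i → var (n ↑ʳ i))) (ws ++ᵥ xs)  ≡⟨ evs-tab (n ↑ʳ_) (ws ++ᵥ xs) ⟩
    tabulate (λ i → lookup (ws ++ᵥ xs) (n ↑ʳ i))     ≡⟨ tabulate-cong (lookup-++ʳ ws xs) ⟩
    tabulate (lookup xs)                           ≡⟨ tabulate∘lookup xs ⟩
    xs                                             ∎)
    where open ≡-Reasoning

  sumN-cong : ∀ n {g h : ℕ → ℕ} → (∀ i → i < n → g i ≡ h i) → sumN n g ≡ sumN n h
  sumN-cong zero e = refl
  sumN-cong (suc n) e = cong₂ _+_ (sumN-cong n λ i i<n → e i (m<n⇒m<1+n i<n)) (e n ≤-refl)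

  tr-eq⇒ : ∀ x y → Tr (1 ∸ ((x ∸ y) + (y ∸ x))) → x ≡ y
  tr-eq⇒ x y h with (x ∸ y) + (y ∸ x) in eq
  ... | zero = ≤-antisym (m∸n≡0⇒m≤n (m+n≡0⇒m≡0 _ eq)) (m∸n≡0⇒m≤n (m+n≡0⇒n≡0 (x ∸ y) eq))
  ... | suc m = ⊥-elim (<-irrefl (sym (0∸n≡0 m)) h)

  tr-eq⇐ : ∀ x y → x ≡ y → Tr (1 ∸ ((x ∸ y) + (y ∸ x)))
  tr-eq⇐ x .x refl rewrite n∸n≡0 x = s≤s z≤n

  tr-lt⇒ : ∀ x y → Tr (y ∸ x) → x < y
  tr-lt⇒ x y h with x <? y
  ... | yes p = p
  ... | no p = ⊥-elim (<-irrefl (sym (m≤n⇒m∸n≡0 (≮⇒≥ p))) h)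

  tr-lt⇐ : ∀ x y → x < y → Tr (y ∸ x)
  tr-lt⇐ x y = m<n⇒0<n∸m

  tr-and⇒ : ∀ x y → Tr (x * y) → Tr x × Tr y
  tr-and⇒ zero y ()
  tr-and⇒ (suc x) zero h = ⊥-elim (<-irrefl (sym (*-zeroʳ x)) h)
  tr-and⇒ (suc x) (suc y) h = s≤s z≤n , s≤s z≤n

  tr-and⇐ : ∀ x y → Tr x → Tr y → Tr (x * y)
  tr-and⇐ (suc x) (suc y) _ _ = s≤s z≤n

  tr-or⇒ : ∀ x y → Tr (x + y) → Tr x ⊎ Tr y
  tr-or⇒ zero y h = inj₂ h
  tr-or⇒ (suc x) y h = inj₁ (s≤s z≤n)

  tr-or⇐₁ : ∀ x y → Tr x → Tr (x + y)
  tr-or⇐₁ (suc x) y _ = s≤s z≤n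

  tr-or⇐₂ : ∀ x y → Tr y → Tr (x + y)
  tr-or⇐₂ x y h = ≤-trans h (m≤n+m y x)

  tr-neg⇒ : ∀ x → Tr (1 ∸ x) → ¬ Tr x
  tr-neg⇒ zero _ ()
  tr-neg⇒ (suc x) h _ = <-irrefl (sym (0∸n≡0 x)) h

  tr-neg⇐ : ∀ x → ¬ Tr x → Tr (1 ∸ x)
  tr-neg⇐ x h rewrite ¬Tr⇒0 h = s≤s z≤n

  tr-imp⇒ : ∀ x y → Tr ((1 ∸ x) + y) → Tr x → Tr y
  tr-imp⇒ x y h hx with tr-or⇒ (1 ∸ x) y h
  ... | inj₁ p = ⊥-elim (tr-neg⇒ x p hx)
  ... | inj₂ p = p

  tr-imp⇐ : ∀ x y → (Tr x → Tr y) → Tr ((1 ∸ x) + y)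
  tr-imp⇐ x y h with Tr? x
  ... | yes p = tr-or⇐₂ (1 ∸ x) y (h p)
  ... | no p = tr-or⇐₁ (1 ∸ x) y (tr-neg⇐ x p)

  sg01 : ∀ x → (Tr x × 1 ∸ (1 ∸ x) ≡ 1) ⊎ (¬ Tr x × 1 ∸ (1 ∸ x) ≡ 0)
  sg01 zero = inj₂ ((λ ()) , refl)
  sg01 (suc x) = inj₁ (s≤s z≤n , cong (1 ∸_) (0∸n≡0 x))

  tr-sum⇒ : ∀ n (g : ℕ → ℕ) → Tr (sumN n g) → Σ ℕ λ i → i < n × Tr (g i)
  tr-sum⇒ zero g ()
  tr-sum⇒ (suc n) g h with tr-or⇒ (sumN n g) (g n) h
  ... | inj₁ p = let (i , i<n , q) = tr-sum⇒ n g p in i , m<n⇒m<1+n i<n , q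
  ... | inj₂ p = n , ≤-refl , p

  tr-sum⇐ : ∀ n (g : ℕ → ℕ) i → i < n → Tr (g i) → Tr (sumN n g)
  tr-sum⇐ (suc n) g i i<n h with i <? n
  ... | yes p = tr-or⇐₁ (sumN n g) (g n) (tr-sum⇐ n g i p h)
  ... | no p rewrite ≤-antisym (≤-pred i<n) (≮⇒≥ p) = tr-or⇐₂ (sumN n g) (g n) h

  tr-all⇒ : ∀ n (g : ℕ → ℕ) → Tr (1 ∸ sumN n (λ i → 1 ∸ g i)) → ∀ i → i < n → Tr (g i)
  tr-all⇒ n g h i i<n with Tr? (g i)
  ... | yes p = p
  ... | no p = ⊥-elim (tr-neg⇒ (sumN n (λ i → 1 ∸ g i)) h (tr-sum⇐ n (λ i → 1 ∸ g i) i i<n (tr-neg⇐ (g i) p)))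

  tr-all⇐ : ∀ n (g : ℕ → ℕ) → (∀ i → i < n → Tr (g i)) → Tr (1 ∸ sumN n (λ i → 1 ∸ g i))
  tr-all⇐ n g h = tr-neg⇐ (sumN n (λ i → 1 ∸ g i)) λ q → let (i , i<n , r) = tr-sum⇒ n (λ i → 1 ∸ g i) q in tr-neg⇒ (g i) r (h i i<n)

  muN : ℕ → (ℕ → ℕ) → ℕ
  muN n p = sumN n (λ j → 1 ∸ sumN (suc j) p)

  sum0 : ∀ n (p : ℕ → ℕ) → (∀ i → i < n → ¬ Tr (p i)) → sumN n p ≡ 0
  sum0 n p h with Tr? (sumN n p)
  ... | yes q = let (i , i<n , r) = tr-sum⇒ n p q in ⊥-elim (h i i<n r)
  ... | no q = ¬Tr⇒0 q

  muN-below : ∀ n w (p : ℕ → ℕ) → n ≤ w → (∀ i → i < w → ¬ Tr (p i)) → muN n p ≡ n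
  muN-below zero w p _ _ = refl
  muN-below (suc n) w p n<w h =
    trans (cong₂ _+_ (muN-below n w p (<⇒≤ n<w) h)
                     (cong (λ z → 1 ∸ z) (sum0 (suc n) p λ i i<sn → h i (≤-trans i<sn n<w))))
          (+-comm n 1)

  Tr⇒1∸≡0 : ∀ x → Tr x → 1 ∸ x ≡ 0
  Tr⇒1∸≡0 (suc x) _ = 0∸n≡0 x

  muN-above : ∀ n w (p : ℕ → ℕ) → w ≤ n → Tr (p w) → (∀ i → i < w → ¬ Tr (p i)) → muN n p ≡ w
  muN-above n w p w≤n hw h with m≤n⇒m<n∨m≡n w≤n
  ... | inj₂ refl = muN-below n n p ≤-refl h
  muN-above (suc m) w p w≤n hw h | inj₁ (s≤s w≤m) =
    trans (cong₂ _+_ (muN-above m w p w≤m hw h)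
                     (Tr⇒1∸≡0 (sumN (suc m) p) (tr-sum⇐ (suc m) p w (s≤s w≤m) hw)))
          (+-identityʳ w)

  muN≤ : ∀ n (p : ℕ → ℕ) → muN n p ≤ n
  muN≤ zero p = ≤-refl
  muN≤ (suc n) p = subst (_≤ suc n) (+-comm (1 ∸ sumN (suc n) p) (muN n p)) (+-mono-≤ (m∸n≤m 1 (sumN (suc n) p)) (muN≤ n p))

  least-or : ∀ n (P : ℕ → Set) → (∀ i → Dec (P i)) →
    (Σ ℕ λ w → w < n × P w × (∀ i → i < w → ¬ P i)) ⊎ (∀ i → i < n → ¬ P i)
  least-or zero P d = inj₂ λ _ ()
  least-or (suc n) P d with least-or n P d
  ... | inj₁ (w , w<n , pW , h) = inj₁ (w , m<n⇒m<1+n w<n , pW , h)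
  ... | inj₂ h with d n
  ...   | yes pn = inj₁ (n , ≤-refl , pn , h)
  ...   | no ¬pn = inj₂ λ i i<sn → lem i i<sn
    where
    lem : ∀ i → i < suc n → ¬ P i
    lem i i<sn with i <? n
    ... | yes p = h i p
    ... | no p rewrite ≤-antisym (≤-pred i<sn) (≮⇒≥ p) = ¬pn

  least : ∀ n (P : ℕ → Set) → (∀ i → Dec (P i)) → (Σ ℕ λ w → w < n × P w) →
          Σ ℕ λ w → w < n × P w × (∀ i → i < w → ¬ P i)
  least n P d (w , w<n , pW) with least-or n P d
  ... | inj₁ r = r
  ... | inj₂ h = ⊥-elim (h w w<n pW)

  ev-muT : ∀ {k} (n : Tm k) (φ : Tm (suc k)) xs → ev (muT n φ) xs ≡ muN (ev n xs) (λ i → ev φ (i ∷ xs))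
  ev-muT n φ xs = sumN-cong (ev n xs) λ j _ → cong (1 ∸_) (sumN-cong (suc j) λ i _ → ev-wk1 φ i j xs)

module Pairing where

  open Terms
  open TruthTerms

  pair-even : ∀ a b → ⟨ suc a , b ⟩ ≡ 2 * ⟨ a , b ⟩
  pair-even a b = *-assoc 2 (2 ^ a) (2 * b + 1)

  pair-zero : ∀ b → ⟨ 0 , b ⟩ ≡ suc (2 * b)
  pair-zero b = trans (+-identityʳ (2 * b + 1)) (+-comm (2 * b) 1)

  pair-inj : ∀ a b a' b' → ⟨ a , b ⟩ ≡ ⟨ a' , b' ⟩ → a ≡ a' × b ≡ b'
  pair-inj zero b zero b' e =
    refl , *-cancelˡ-≡ b b' 2 (suc-injective (trans (sym (pair-zero b)) (trans e (pair-zero b'))))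
  pair-inj zero b (suc a') b' e =
    ⊥-elim (even≢odd ⟨ a' , b' ⟩ b (trans (sym (pair-even a' b')) (trans (sym e) (pair-zero b))))
  pair-inj (suc a) b zero b' e =
    ⊥-elim (even≢odd ⟨ a , b ⟩ b' (trans (sym (pair-even a b)) (trans e (pair-zero b'))))
  pair-inj (suc a) b (suc a') b' e with pair-inj a b a' b'
    (*-cancelˡ-≡ _ _ 2 (trans (sym (pair-even a b)) (trans e (pair-even a' b'))))
  ... | refl , q = refl , q

  pair-pos : ∀ a b → 0 < ⟨ a , b ⟩
  pair-pos a b = *-mono-< (m^n>0 2 a) (subst (0 <_) (+-comm 1 (2 * b)) (s≤s z≤n))

  pow-big : ∀ a → a < 2 ^ a
  pow-big zero = s≤s z≤n
  pow-big (suc a) = subst₂ _≤_ (+-comm (suc a) 1) (cong (2 ^ a +_) (sym (+-identityʳ (2 ^ a)))) (+-mono-≤ (pow-big a) (m^n>0 2 a))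

  odd-pos : ∀ b → 0 < 2 * b + 1
  odd-pos b = subst (0 <_) (+-comm 1 (2 * b)) (s≤s z≤n)

  pair-fst< : ∀ a b → a < ⟨ a , b ⟩
  pair-fst< a b = <-≤-trans (pow-big a) (m≤m*n (2 ^ a) (2 * b + 1) {{>-nonZero (odd-pos b)}})

  pair-snd< : ∀ a b → b < ⟨ a , b ⟩
  pair-snd< a b = <-≤-trans (subst (b <_) (+-comm 1 (2 * b)) (s≤s (m≤m+n b (b + 0))))
                            (m≤n*m (2 * b + 1) (2 ^ a) {{>-nonZero (m^n>0 2 a)}})

  parity : ∀ n → Σ ℕ λ m → (n ≡ 2 * m) ⊎ (n ≡ 2 * m + 1)
  parity zero = 0 , inj₁ refl
  parity (suc n) with parity n
  ... | m , inj₁ e = m , inj₂ (trans (cong suc e) (+-comm 1 (2 * m)))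
  ... | m , inj₂ e = suc m , inj₁ (trans (cong suc (trans e (+-comm (2 * m) 1))) (sym (cong suc (+-suc m (m + 0)))))

  pair-surj' : ∀ fuel n → n ≤ fuel → 0 < n → Σ ℕ λ a → Σ ℕ λ b → ⟨ a , b ⟩ ≡ n
  pair-surj' fuel n n≤f 0<n with parity n
  ... | b , inj₂ e = 0 , b , trans (trans (pair-zero b) (+-comm 1 (2 * b))) (sym e)
  pair-surj' zero n n≤f 0<n | m , inj₁ e = ⊥-elim (<-irrefl refl (<-≤-trans 0<n n≤f))
  pair-surj' (suc fuel) n n≤f 0<n | zero , inj₁ e = ⊥-elim (<-irrefl (sym e) 0<n)
  pair-surj' (suc fuel) n n≤f 0<n | suc m , inj₁ e
    with pair-surj' fuel (suc m) (≤-pred (<-≤-trans (m<2m (suc m) (s≤s z≤n)) (subst (_≤ suc fuel) e n≤f))) (s≤s z≤n)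
    where
    m<2m : ∀ k → 0 < k → k < 2 * k
    m<2m (suc k) _ = s≤s (subst (suc k ≤_) (sym (+-suc k (k + 0))) (s≤s (m≤m+n k (k + 0))))
  ... | a , b , e' = suc a , b , trans (pair-even a b) (trans (cong (2 *_) e') (sym e))

  pair-surj : ∀ n → 0 < n → Σ ℕ λ a → Σ ℕ λ b → ⟨ a , b ⟩ ≡ n
  pair-surj n = pair-surj' n n ≤-refl

module SequenceCodes where

  open Terms
  open TruthTerms
  open Pairing

  v0 : ∀ {k} → Tm (suc k)
  v0 = var zero
  v1 : ∀ {k} → Tm (suc (suc k))
  v1 = var (suc zero)
  v2 : ∀ {k} → Tm (suc (suc (suc k)))
  v2 = var (suc (suc zero))
  v3 : ∀ {k} → Tm (suc (suc (suc (suc k))))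
  v3 = var (suc (suc (suc zero)))
  v4 : ∀ {k} → Tm (suc (suc (suc (suc (suc k)))))
  v4 = var (suc (suc (suc (suc zero))))
  v5 : ∀ {k} → Tm (suc (suc (suc (suc (suc (suc k))))))
  v5 = var (suc (suc (suc (suc (suc zero)))))

  -- Kept opaque: unfolding these bounded searches would make conversion checking explode.
  opaque
    hdT tlT : Tm 1
    hdT = muT v0 (exT v1 (eqT ⟪ v1 , v0 ⟫ v2))
    tlT = muT v0 (exT v1 (eqT ⟪ v0 , v1 ⟫ v2))

  hd tl : ℕ → ℕ
  hd S = ev hdT (S ∷ [])
  tl S = ev tlT (S ∷ [])

  hd₁ tl₁ : ∀ {k} → Tm k → Tm k
  hd₁ t = sub hdT (t ∷ [])
  tl₁ t = sub tlT (t ∷ [])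

  opaque
    unfolding hdT tlT
    hd-pair : ∀ a b → hd ⟨ a , b ⟩ ≡ a
    hd-pair a b = trans (ev-muT v0 (exT v1 (eqT ⟪ v1 , v0 ⟫ v2)) (S ∷ []))
       (muN-above S a _ (<⇒≤ (pair-fst< a b))
         (tr-sum⇐ S _ b (pair-snd< a b) (tr-eq⇐ ⟨ a , b ⟩ S refl))
         λ i i<a h → let (b' , _ , q) = tr-sum⇒ S _ h in
            <-irrefl (proj₁ (pair-inj i b' a b (tr-eq⇒ ⟨ i , b' ⟩ S q))) i<a)
      where S : ℕ
            S = ⟨ a , b ⟩

    tl-pair : ∀ a b → tl ⟨ a , b ⟩ ≡ b
    tl-pair a b = trans (ev-muT v0 (exT v1 (eqT ⟪ v0 , v1 ⟫ v2)) (S ∷ []))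
       (muN-above S b _ (<⇒≤ (pair-snd< a b))
         (tr-sum⇐ S _ a (pair-fst< a b) (tr-eq⇐ ⟨ a , b ⟩ S refl))
         λ i i<b h → let (a' , _ , q) = tr-sum⇒ S _ h in
            <-irrefl (proj₂ (pair-inj a' i a b (tr-eq⇒ ⟨ a' , i ⟩ S q))) i<b)
      where S : ℕ
            S = ⟨ a , b ⟩

    tl0 : tl 0 ≡ 0
    tl0 = refl

    hd≤ : ∀ n → hd n ≤ n
    hd≤ n = subst (_≤ n) (sym (ev-muT v0 (exT v1 (eqT ⟪ v1 , v0 ⟫ v2)) (n ∷ []))) (muN≤ n _)

  tl< : ∀ n → 0 < n → tl n < n
  tl< n 0<n with pair-surj n 0<n
  ... | a , b , refl = subst (_< ⟨ a , b ⟩) (sym (tl-pair a b)) (pair-snd< a b)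

  tl≤ : ∀ n → tl n ≤ n
  tl≤ zero = subst (_≤ 0) (sym tl0) z≤n
  tl≤ (suc n) = <⇒≤ (tl< (suc n) (s≤s z≤n))

  opaque
    itlT : Tm 2
    itlT = rc v1 (tl₁ v1) v0

  itl : ℕ → ℕ → ℕ
  itl i S = ev itlT (i ∷ S ∷ [])

  itl₂ : ∀ {k} → Tm k → Tm k → Tm k
  itl₂ i S = sub itlT (i ∷ S ∷ [])

  opaque
    unfolding itlT
    itl-suc : ∀ i S → itl (suc i) S ≡ itl i (tl S)
    itl-suc zero S = refl
    itl-suc (suc i) S = cong tl (itl-suc i S)

    itl-zero : ∀ i → itl i 0 ≡ 0
    itl-zero zero = refl
    itl-zero (suc i) = trans (cong tl (itl-zero i)) tl0

    itl-step : ∀ i S → itl (suc i) S ≡ tl (itl i S)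
    itl-step i S = refl

    itl0 : ∀ S → itl 0 S ≡ S
    itl0 S = refl

  itl-pair : ∀ i a b → itl (suc i) ⟨ a , b ⟩ ≡ itl i b
  itl-pair i a b = trans (itl-suc i ⟨ a , b ⟩) (cong (itl i) (tl-pair a b))

  itl≤ : ∀ i S → itl i S ≤ S
  itl≤ zero S = subst (_≤ S) (sym (itl0 S)) ≤-refl
  itl≤ (suc i) S = subst (_≤ S) (sym (itl-step i S)) (≤-trans (tl≤ (itl i S)) (itl≤ i S))

  itl-pos : ∀ i S → 0 < itl i S → i < S
  itl-pos zero S h = subst (0 <_) (itl0 S) h
  itl-pos (suc i) S h = <-≤-trans (s≤s (itl-pos i (tl S) (subst (0 <_) (itl-suc i S) h)))
                         (tl< S (<-≤-trans h (itl≤ (suc i) S)))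

  itl-+ : ∀ j i S → itl j (itl i S) ≡ itl (j + i) S
  itl-+ zero i S = itl0 (itl i S)
  itl-+ (suc j) i S = trans (itl-step j (itl i S)) (trans (cong tl (itl-+ j i S)) (sym (itl-step (j + i) S)))

  vc : ∀ {k} → Vec ℕ k → ℕ
  vc [] = 0
  vc (x ∷ v) = ⟨ x , vc v ⟩

  vc-inj : ∀ {k k'} (v : Vec ℕ k) (w : Vec ℕ k') → vc v ≡ vc w → Σ (k ≡ k') λ { refl → v ≡ w }
  vc-inj [] [] e = refl , refl
  vc-inj [] (y ∷ w) e = ⊥-elim (<-irrefl e (pair-pos y (vc w)))
  vc-inj (x ∷ v) [] e = ⊥-elim (<-irrefl (sym e) (pair-pos x (vc v)))
  vc-inj (x ∷ v) (y ∷ w) e with pair-inj x (vc v) y (vc w) e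
  ... | refl , e' with vc-inj v w e'
  ... | refl , refl = refl , refl

  opaque
    lenT : Tm 1
    lenT = muT (v0 ⊕ lit 1) (eqT (itl₂ v0 v1) (lit 0))

  len : ℕ → ℕ
  len S = ev lenT (S ∷ [])

  len₁ : ∀ {k} → Tm k → Tm k
  len₁ t = sub lenT (t ∷ [])

  itl-vc : ∀ {k} (v : Vec ℕ k) → itl k (vc v) ≡ 0
  itl-vc [] = itl0 0
  itl-vc {suc k} (x ∷ v) = trans (itl-pair k x (vc v)) (itl-vc v)

  itl-vc-pos : ∀ {k} (v : Vec ℕ k) i → i < k → 0 < itl i (vc v)
  itl-vc-pos (x ∷ v) zero _ = subst (0 <_) (sym (itl0 _)) (pair-pos x (vc v))
  itl-vc-pos (x ∷ v) (suc i) (s≤s i<k) = subst (0 <_) (sym (itl-pair i x (vc v))) (itl-vc-pos v i i<k)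

  k≤vc : ∀ {k} (v : Vec ℕ k) → k ≤ vc v
  k≤vc [] = z≤n
  k≤vc (x ∷ v) = ≤-trans (s≤s (k≤vc v)) (pair-snd< x (vc v))

  opaque
    unfolding lenT
    len-vc : ∀ {k} (v : Vec ℕ k) → len (vc v) ≡ k
    len-vc {k} v = trans (ev-muT (v0 ⊕ lit 1) (eqT (itl₂ v0 v1) (lit 0)) (vc v ∷ []))
      (muN-above (vc v + 1) k _ (≤-trans (k≤vc v) (m≤m+n (vc v) 1))
         (tr-eq⇐ (itl k (vc v)) 0 (itl-vc v))
         λ i i<k h → <-irrefl (sym (tr-eq⇒ (itl i (vc v)) 0 h)) (itl-vc-pos v i i<k))

  nth : ℕ → ℕ → ℕ
  nth S i = hd (itl i S)

  nth-vc : ∀ {k} (v : Vec ℕ k) (i : Fin k) → nth (vc v) (toℕ i) ≡ lookup v i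
  nth-vc (x ∷ v) zero = trans (cong hd (itl0 _)) (hd-pair x (vc v))
  nth-vc (x ∷ v) (suc i) = trans (cong hd (itl-pair (toℕ i) x (vc v))) (nth-vc v i)

module CodeInjectivity where

  open Terms
  open TruthTerms
  open Pairing
  open SequenceCodes

  mutual
    code-inj : ∀ {n} (c d : Code n) → ⌜ c ⌝ ≡ ⌜ d ⌝ → c ≡ d
    code-inj zer zer e = refl
    code-inj succ succ e = refl
    code-inj orc orc e = refl
    code-inj {n} (proj i) (proj j) e =
      cong proj (toℕ-injective (proj₂ (pair-inj n (toℕ i) n (toℕ j) (proj₂ (pair-inj 2 ⟨ n , toℕ i ⟩ 2 ⟨ n , toℕ j ⟩ e)))))
    code-inj {n} (comp {m = m} c cs) (comp {m = m'} d ds) e =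
      let (em , e2) = pair-inj m ⟨ ⌜ c ⌝ , ⌜ cs ⌝v ⟩ m' ⟨ ⌜ d ⌝ , ⌜ ds ⌝v ⟩
             (proj₂ (pair-inj n ⟨ m , ⟨ ⌜ c ⌝ , ⌜ cs ⌝v ⟩ ⟩ n ⟨ m' , ⟨ ⌜ d ⌝ , ⌜ ds ⌝v ⟩ ⟩
               (proj₂ (pair-inj 4 ⟨ n , ⟨ m , ⟨ ⌜ c ⌝ , ⌜ cs ⌝v ⟩ ⟩ ⟩ 4 ⟨ n , ⟨ m' , ⟨ ⌜ d ⌝ , ⌜ ds ⌝v ⟩ ⟩ ⟩ e))))
      in comp-help c cs d ds em e2
    code-inj {suc n} (prec g h) (prec g' h') e =
      let (e1 , e2) = pair-inj ⌜ g ⌝ ⌜ h ⌝ ⌜ g' ⌝ ⌜ h' ⌝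
             (proj₂ (pair-inj n ⟨ ⌜ g ⌝ , ⌜ h ⌝ ⟩ n ⟨ ⌜ g' ⌝ , ⌜ h' ⌝ ⟩
               (proj₂ (pair-inj 5 ⟨ n , ⟨ ⌜ g ⌝ , ⌜ h ⌝ ⟩ ⟩ 5 ⟨ n , ⟨ ⌜ g' ⌝ , ⌜ h' ⌝ ⟩ ⟩ e))))
      in cong₂ prec (code-inj g g' e1) (code-inj h h' e2)
    code-inj {n} (mu c) (mu d) e =
      cong mu (code-inj c d (proj₂ (pair-inj n ⌜ c ⌝ n ⌜ d ⌝ (proj₂ (pair-inj 6 ⟨ n , ⌜ c ⌝ ⟩ 6 ⟨ n , ⌜ d ⌝ ⟩ e)))))
    code-inj zer succ e = contradiction (proj₁ (pair-inj 0 (1) 1 (0) e)) (λ ())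
    code-inj {n} zer (proj i') e = contradiction (proj₁ (pair-inj 0 (n) 2 (⟨ n , toℕ i' ⟩) e)) (λ ())
    code-inj zer orc e = contradiction (proj₁ (pair-inj 0 (1) 3 (0) e)) (λ ())
    code-inj {n} zer (comp {m = m'} c' cs') e = contradiction (proj₁ (pair-inj 0 (n) 4 (⟨ n , ⟨ m' , ⟨ ⌜ c' ⌝ , ⌜ cs' ⌝v ⟩ ⟩ ⟩) e)) (λ ())
    code-inj {n} zer (prec g' h') e = contradiction (proj₁ (pair-inj 0 (n) 5 (⟨ pred n , ⟨ ⌜ g' ⌝ , ⌜ h' ⌝ ⟩ ⟩) e)) (λ ())
    code-inj {n} zer (mu c') e = contradiction (proj₁ (pair-inj 0 (n) 6 (⟨ n , ⌜ c' ⌝ ⟩) e)) (λ ())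
    code-inj succ zer e = contradiction (proj₁ (pair-inj 1 (0) 0 (1) e)) (λ ())
    code-inj succ (proj i') e = contradiction (proj₁ (pair-inj 1 (0) 2 (⟨ 1 , toℕ i' ⟩) e)) (λ ())
    code-inj succ orc e = contradiction (proj₁ (pair-inj 1 (0) 3 (0) e)) (λ ())
    code-inj succ (comp {m = m'} c' cs') e = contradiction (proj₁ (pair-inj 1 (0) 4 (⟨ 1 , ⟨ m' , ⟨ ⌜ c' ⌝ , ⌜ cs' ⌝v ⟩ ⟩ ⟩) e)) (λ ())
    code-inj succ (prec g' h') e = contradiction (proj₁ (pair-inj 1 (0) 5 (⟨ 0 , ⟨ ⌜ g' ⌝ , ⌜ h' ⌝ ⟩ ⟩) e)) (λ ())
    code-inj succ (mu c') e = contradiction (proj₁ (pair-inj 1 (0) 6 (⟨ 1 , ⌜ c' ⌝ ⟩) e)) (λ ())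
    code-inj {n} (proj i) zer e = contradiction (proj₁ (pair-inj 2 (⟨ n , toℕ i ⟩) 0 (n) e)) (λ ())
    code-inj (proj i) succ e = contradiction (proj₁ (pair-inj 2 (⟨ 1 , toℕ i ⟩) 1 (0) e)) (λ ())
    code-inj (proj i) orc e = contradiction (proj₁ (pair-inj 2 (⟨ 1 , toℕ i ⟩) 3 (0) e)) (λ ())
    code-inj {n} (proj i) (comp {m = m'} c' cs') e = contradiction (proj₁ (pair-inj 2 (⟨ n , toℕ i ⟩) 4 (⟨ n , ⟨ m' , ⟨ ⌜ c' ⌝ , ⌜ cs' ⌝v ⟩ ⟩ ⟩) e)) (λ ())
    code-inj {n} (proj i) (prec g' h') e = contradiction (proj₁ (pair-inj 2 (⟨ n , toℕ i ⟩) 5 (⟨ pred n , ⟨ ⌜ g' ⌝ , ⌜ h' ⌝ ⟩ ⟩) e)) (λ ())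
    code-inj {n} (proj i) (mu c') e = contradiction (proj₁ (pair-inj 2 (⟨ n , toℕ i ⟩) 6 (⟨ n , ⌜ c' ⌝ ⟩) e)) (λ ())
    code-inj orc zer e = contradiction (proj₁ (pair-inj 3 (0) 0 (1) e)) (λ ())
    code-inj orc succ e = contradiction (proj₁ (pair-inj 3 (0) 1 (0) e)) (λ ())
    code-inj orc (proj i') e = contradiction (proj₁ (pair-inj 3 (0) 2 (⟨ 1 , toℕ i' ⟩) e)) (λ ())
    code-inj orc (comp {m = m'} c' cs') e = contradiction (proj₁ (pair-inj 3 (0) 4 (⟨ 1 , ⟨ m' , ⟨ ⌜ c' ⌝ , ⌜ cs' ⌝v ⟩ ⟩ ⟩) e)) (λ ())
    code-inj orc (prec g' h') e = contradiction (proj₁ (pair-inj 3 (0) 5 (⟨ 0 , ⟨ ⌜ g' ⌝ , ⌜ h' ⌝ ⟩ ⟩) e)) (λ ())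
    code-inj orc (mu c') e = contradiction (proj₁ (pair-inj 3 (0) 6 (⟨ 1 , ⌜ c' ⌝ ⟩) e)) (λ ())
    code-inj {n} (comp {m = m} c cs) zer e = contradiction (proj₁ (pair-inj 4 (⟨ n , ⟨ m , ⟨ ⌜ c ⌝ , ⌜ cs ⌝v ⟩ ⟩ ⟩) 0 (n) e)) (λ ())
    code-inj (comp {m = m} c cs) succ e = contradiction (proj₁ (pair-inj 4 (⟨ 1 , ⟨ m , ⟨ ⌜ c ⌝ , ⌜ cs ⌝v ⟩ ⟩ ⟩) 1 (0) e)) (λ ())
    code-inj {n} (comp {m = m} c cs) (proj i') e = contradiction (proj₁ (pair-inj 4 (⟨ n , ⟨ m , ⟨ ⌜ c ⌝ , ⌜ cs ⌝v ⟩ ⟩ ⟩) 2 (⟨ n , toℕ i' ⟩) e)) (λ ())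
    code-inj (comp {m = m} c cs) orc e = contradiction (proj₁ (pair-inj 4 (⟨ 1 , ⟨ m , ⟨ ⌜ c ⌝ , ⌜ cs ⌝v ⟩ ⟩ ⟩) 3 (0) e)) (λ ())
    code-inj {n} (comp {m = m} c cs) (prec g' h') e = contradiction (proj₁ (pair-inj 4 (⟨ n , ⟨ m , ⟨ ⌜ c ⌝ , ⌜ cs ⌝v ⟩ ⟩ ⟩) 5 (⟨ pred n , ⟨ ⌜ g' ⌝ , ⌜ h' ⌝ ⟩ ⟩) e)) (λ ())
    code-inj {n} (comp {m = m} c cs) (mu c') e = contradiction (proj₁ (pair-inj 4 (⟨ n , ⟨ m , ⟨ ⌜ c ⌝ , ⌜ cs ⌝v ⟩ ⟩ ⟩) 6 (⟨ n , ⌜ c' ⌝ ⟩) e)) (λ ())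
    code-inj {n} (prec g h) zer e = contradiction (proj₁ (pair-inj 5 (⟨ pred n , ⟨ ⌜ g ⌝ , ⌜ h ⌝ ⟩ ⟩) 0 (n) e)) (λ ())
    code-inj (prec g h) succ e = contradiction (proj₁ (pair-inj 5 (⟨ 0 , ⟨ ⌜ g ⌝ , ⌜ h ⌝ ⟩ ⟩) 1 (0) e)) (λ ())
    code-inj {n} (prec g h) (proj i') e = contradiction (proj₁ (pair-inj 5 (⟨ pred n , ⟨ ⌜ g ⌝ , ⌜ h ⌝ ⟩ ⟩) 2 (⟨ n , toℕ i' ⟩) e)) (λ ())
    code-inj (prec g h) orc e = contradiction (proj₁ (pair-inj 5 (⟨ 0 , ⟨ ⌜ g ⌝ , ⌜ h ⌝ ⟩ ⟩) 3 (0) e)) (λ ())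
    code-inj {n} (prec g h) (comp {m = m'} c' cs') e = contradiction (proj₁ (pair-inj 5 (⟨ pred n , ⟨ ⌜ g ⌝ , ⌜ h ⌝ ⟩ ⟩) 4 (⟨ n , ⟨ m' , ⟨ ⌜ c' ⌝ , ⌜ cs' ⌝v ⟩ ⟩ ⟩) e)) (λ ())
    code-inj {n} (prec g h) (mu c') e = contradiction (proj₁ (pair-inj 5 (⟨ pred n , ⟨ ⌜ g ⌝ , ⌜ h ⌝ ⟩ ⟩) 6 (⟨ n , ⌜ c' ⌝ ⟩) e)) (λ ())
    code-inj {n} (mu c) zer e = contradiction (proj₁ (pair-inj 6 (⟨ n , ⌜ c ⌝ ⟩) 0 (n) e)) (λ ())
    code-inj (mu c) succ e = contradiction (proj₁ (pair-inj 6 (⟨ 1 , ⌜ c ⌝ ⟩) 1 (0) e)) (λ ())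
    code-inj {n} (mu c) (proj i') e = contradiction (proj₁ (pair-inj 6 (⟨ n , ⌜ c ⌝ ⟩) 2 (⟨ n , toℕ i' ⟩) e)) (λ ())
    code-inj (mu c) orc e = contradiction (proj₁ (pair-inj 6 (⟨ 1 , ⌜ c ⌝ ⟩) 3 (0) e)) (λ ())
    code-inj {n} (mu c) (comp {m = m'} c' cs') e = contradiction (proj₁ (pair-inj 6 (⟨ n , ⌜ c ⌝ ⟩) 4 (⟨ n , ⟨ m' , ⟨ ⌜ c' ⌝ , ⌜ cs' ⌝v ⟩ ⟩ ⟩) e)) (λ ())
    code-inj {n} (mu c) (prec g' h') e = contradiction (proj₁ (pair-inj 6 (⟨ n , ⌜ c ⌝ ⟩) 5 (⟨ pred n , ⟨ ⌜ g' ⌝ , ⌜ h' ⌝ ⟩ ⟩) e)) (λ ())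

    codes-inj : ∀ {k m} (cs ds : Vec (Code k) m) → ⌜ cs ⌝v ≡ ⌜ ds ⌝v → cs ≡ ds
    codes-inj [] [] e = refl
    codes-inj (c ∷ cs) (d ∷ ds) e =
      let (e1 , e2) = pair-inj ⌜ c ⌝ ⌜ cs ⌝v ⌜ d ⌝ ⌜ ds ⌝v e
      in cong₂ _∷_ (code-inj c d e1) (codes-inj cs ds e2)

    comp-help : ∀ {n m m'} (c : Code m) (cs : Vec (Code n) m) (d : Code m') (ds : Vec (Code n) m') →
      m ≡ m' → ⟨ ⌜ c ⌝ , ⌜ cs ⌝v ⟩ ≡ ⟨ ⌜ d ⌝ , ⌜ ds ⌝v ⟩ → comp c cs ≡ comp d ds
    comp-help c cs d ds refl e2 =
      let (e3 , e4) = pair-inj ⌜ c ⌝ ⌜ cs ⌝v ⌜ d ⌝ ⌜ ds ⌝v e2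
      in cong₂ comp (code-inj c d e3) (codes-inj cs ds e4)


module BoundedFormulas where

  open Terms
  open TruthTerms
  open Pairing
  open SequenceCodes

  Mem : ℕ → ℕ → Set
  Mem S X = Σ ℕ λ i → i < S × 0 < itl i S × hd (itl i S) ≡ X

  data Fm (k : ℕ) : Set where
    eqF ltF : Tm k → Tm k → Fm k
    andF orF impF : Fm k → Fm k → Fm k
    notF : Fm k → Fm k
    exF allF : Tm k → Fm (suc k) → Fm k
    memF : Tm k → Tm k → Fm k
    subF : ∀ {m} → Fm m → Vec (Tm k) m → Fm k

  holds : ∀ {k} → Fm k → Vec ℕ k → Set
  holds (eqF a b) xs = ev a xs ≡ ev b xs
  holds (ltF a b) xs = ev a xs < ev b xs
  holds (andF φ ψ) xs = holds φ xs × holds ψ xs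
  holds (orF φ ψ) xs = holds φ xs ⊎ holds ψ xs
  holds (impF φ ψ) xs = holds φ xs → holds ψ xs
  holds (notF φ) xs = ¬ holds φ xs
  holds (exF t φ) xs = Σ ℕ λ i → i < ev t xs × holds φ (i ∷ xs)
  holds (allF t φ) xs = ∀ i → i < ev t xs → holds φ (i ∷ xs)
  holds (memF X S) xs = Mem (ev S xs) (ev X xs)
  holds (subF φ ts) xs = holds φ (evs ts xs)

  toT : ∀ {k} → Fm k → Tm k
  toT (eqF a b) = eqT a b
  toT (ltF a b) = ltT a b
  toT (andF φ ψ) = andT (toT φ) (toT ψ)
  toT (orF φ ψ) = orT (toT φ) (toT ψ)
  toT (impF φ ψ) = impT (toT φ) (toT ψ)
  toT (notF φ) = negT (toT φ)
  toT (exF t φ) = exT t (toT φ)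
  toT (allF t φ) = allT t (toT φ)
  toT (memF X S) = exT S (andT (ltT (lit 0) (itl₂ v0 (wk S))) (eqT (hd₁ (itl₂ v0 (wk S))) (wk X)))
  toT (subF φ ts) = sub (toT φ) ts

  mutual
    refl⇒ : ∀ {k} (φ : Fm k) xs → Tr (ev (toT φ) xs) → holds φ xs
    refl⇒ (eqF a b) xs h = tr-eq⇒ (ev a xs) (ev b xs) h
    refl⇒ (ltF a b) xs h = tr-lt⇒ (ev a xs) (ev b xs) h
    refl⇒ (andF φ ψ) xs h = let (p , q) = tr-and⇒ _ _ h in refl⇒ φ xs p , refl⇒ ψ xs q
    refl⇒ (orF φ ψ) xs h with tr-or⇒ (ev (toT φ) xs) _ h
    ... | inj₁ p = inj₁ (refl⇒ φ xs p)
    ... | inj₂ p = inj₂ (refl⇒ ψ xs p)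
    refl⇒ (impF φ ψ) xs h hφ = refl⇒ ψ xs (tr-imp⇒ (ev (toT φ) xs) _ h (refl⇐ φ xs hφ))
    refl⇒ (notF φ) xs h hφ = tr-neg⇒ (ev (toT φ) xs) h (refl⇐ φ xs hφ)
    refl⇒ (exF t φ) xs h = let (i , i<n , p) = tr-sum⇒ (ev t xs) (λ i → ev (toT φ) (i ∷ xs)) h in
      i , i<n , refl⇒ φ (i ∷ xs) p
    refl⇒ (allF t φ) xs h i i<n = refl⇒ φ (i ∷ xs) (tr-all⇒ (ev t xs) (λ i → ev (toT φ) (i ∷ xs)) h i i<n)
    refl⇒ (memF X S) xs h =
      let (i , i<n , p) = tr-sum⇒ (ev S xs) _ h
          (q , r) = tr-and⇒ _ _ p
      in i , i<n , subst (λ z → 0 < itl i z) (ev-wk S i xs) (tr-lt⇒ 0 _ q)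
               , subst₂ (λ z w → hd (itl i z) ≡ w) (ev-wk S i xs) (ev-wk X i xs) (tr-eq⇒ _ _ r)
    refl⇒ (subF φ ts) xs h = refl⇒ φ (evs ts xs) h

    refl⇐ : ∀ {k} (φ : Fm k) xs → holds φ xs → Tr (ev (toT φ) xs)
    refl⇐ (eqF a b) xs h = tr-eq⇐ (ev a xs) (ev b xs) h
    refl⇐ (ltF a b) xs h = tr-lt⇐ (ev a xs) (ev b xs) h
    refl⇐ (andF φ ψ) xs (p , q) = tr-and⇐ _ _ (refl⇐ φ xs p) (refl⇐ ψ xs q)
    refl⇐ (orF φ ψ) xs (inj₁ p) = tr-or⇐₁ _ _ (refl⇐ φ xs p)
    refl⇐ (orF φ ψ) xs (inj₂ p) = tr-or⇐₂ (ev (toT φ) xs) _ (refl⇐ ψ xs p)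
    refl⇐ (impF φ ψ) xs h = tr-imp⇐ (ev (toT φ) xs) _ λ p → refl⇐ ψ xs (h (refl⇒ φ xs p))
    refl⇐ (notF φ) xs h = tr-neg⇐ (ev (toT φ) xs) λ p → h (refl⇒ φ xs p)
    refl⇐ (exF t φ) xs (i , i<n , p) = tr-sum⇐ (ev t xs) (λ i → ev (toT φ) (i ∷ xs)) i i<n (refl⇐ φ (i ∷ xs) p)
    refl⇐ (allF t φ) xs h = tr-all⇐ (ev t xs) (λ i → ev (toT φ) (i ∷ xs)) λ i i<n → refl⇐ φ (i ∷ xs) (h i i<n)
    refl⇐ (memF X S) xs (i , i<n , p , q) =
      tr-sum⇐ (ev S xs) _ i i<n
        (tr-and⇐ _ _ (tr-lt⇐ 0 _ (subst (λ z → 0 < itl i z) (sym (ev-wk S i xs)) p))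
                     (tr-eq⇐ _ _ (subst₂ (λ z w → hd (itl i z) ≡ w) (sym (ev-wk S i xs)) (sym (ev-wk X i xs)) q)))
    refl⇐ (subF φ ts) xs h = refl⇐ φ (evs ts xs) h

  holds? : ∀ {k} (φ : Fm k) xs → Dec (holds φ xs)
  holds? φ xs with Tr? (ev (toT φ) xs)
  ... | yes p = yes (refl⇒ φ xs p)
  ... | no p = no λ h → p (refl⇐ φ xs h)

  CPf : (f : ℕ → ℕ) → ∀ {k} → Fm k → Set
  CPf f {k} φ = Σ (Code k) λ c → ∀ xs → (holds φ xs × Eval f c xs 1) ⊎ (¬ holds φ xs × Eval f c xs 0)

  decide : (f : ℕ → ℕ) → ∀ {k} (φ : Fm k) → CPf f φ
  decide f φ = let (c , e) = compile f (sgT (toT φ)) in c , λ xs → go xs (e xs)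
    where
    go : ∀ xs → Eval f (proj₁ (compile f (sgT (toT φ)))) xs (ev (sgT (toT φ)) xs) → _
    go xs e with sg01 (ev (toT φ) xs)
    ... | inj₁ (p , q) = inj₁ (refl⇒ φ xs p , subst (Eval f _ xs) q e)
    ... | inj₂ (p , q) = inj₂ ((λ h → p (refl⇐ φ xs h)) , subst (Eval f _ xs) q e)


  trueF : ∀ {k} → Fm k
  trueF = eqF (lit 0) (lit 0)

  anyF : ∀ {k} n → (Fin n → Fm k) → Fm k
  anyF zero φ = ltF (lit 0) (lit 0)
  anyF (suc n) φ = orF (φ zero) (anyF n (φ ∘ suc))

  anyF→ : ∀ {k} n (φ : Fin n → Fm k) xs → holds (anyF n φ) xs → Σ (Fin n) λ i → holds (φ i) xs
  anyF→ (suc n) φ xs (inj₁ h) = zero , h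
  anyF→ (suc n) φ xs (inj₂ h) = let (i , h′) = anyF→ n (φ ∘ suc) xs h in suc i , h′

  anyF← : ∀ {k} n (φ : Fin n → Fm k) xs i → holds (φ i) xs → holds (anyF n φ) xs
  anyF← (suc n) φ xs zero h = inj₁ h
  anyF← (suc n) φ xs (suc i) h = inj₂ (anyF← n (φ ∘ suc) xs i h)

  -- The witnesses form the first n entries of the environment.
  exN : ∀ {k} n → Tm k → Fm (n + k) → Fm k
  exN zero B φ = φ
  exN (suc n) B φ = exN n B (exF (weakenʳ n B) φ)

  exN→ : ∀ {k} n B (φ : Fm (n + k)) xs → holds (exN n B φ) xs → Σ (Vec ℕ n) λ ws → holds φ (ws ++ᵥ xs)
  exN→ zero B φ xs h = [] , h
  exN→ (suc n) B φ xs h with exN→ n B (exF (weakenʳ n B) φ) xs h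
  ... | ws , (w , _ , h′) = w ∷ ws , h′

  exN← : ∀ {k} n B (φ : Fm (n + k)) xs (ws : Vec ℕ n) →
         (∀ i → lookup ws i < ev B xs) → holds φ (ws ++ᵥ xs) → holds (exN n B φ) xs
  exN← zero B φ xs [] _ h = h
  exN← (suc n) B φ xs (w ∷ ws) bounded h =
    exN← n B (exF (weakenʳ n B) φ) xs ws (bounded ∘ suc)
      (w , subst (w <_) (sym (ev-weakenʳ n B ws xs)) (bounded zero) , h)

module Derivations where

  open Terms
  open TruthTerms
  open Pairing
  open SequenceCodes
  open BoundedFormulas

  -- Judgments about (codes of) programs: EVj n xs y says that the code n maps the coded input
  -- vector xs to y, VVj does the same for a coded vector of codes, SVj n xs i y says that the
  -- μ-search of n on xs started at i returns y, and WFj k n / WVj k m ns say that n codes a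
  -- k-ary program / ns codes m of them.
  EVj VVj : ℕ → ℕ → ℕ → ℕ
  EVj n xs y = ⟨ 0 , ⟨ n , ⟨ xs , y ⟩ ⟩ ⟩
  VVj ns xs ys = ⟨ 1 , ⟨ ns , ⟨ xs , ys ⟩ ⟩ ⟩

  SVj : ℕ → ℕ → ℕ → ℕ → ℕ
  SVj n xs i y = ⟨ 2 , ⟨ n , ⟨ xs , ⟨ i , y ⟩ ⟩ ⟩ ⟩

  WFj : ℕ → ℕ → ℕ
  WFj k n = ⟨ 3 , ⟨ k , n ⟩ ⟩

  WVj : ℕ → ℕ → ℕ → ℕ
  WVj k m ns = ⟨ 4 , ⟨ k , ⟨ m , ns ⟩ ⟩ ⟩

  EVt VVt WVt : ∀ {k} → Tm k → Tm k → Tm k → Tm k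
  EVt n xs y = ⟪ lit 0 , ⟪ n , ⟪ xs , y ⟫ ⟫ ⟫
  VVt ns xs ys = ⟪ lit 1 , ⟪ ns , ⟪ xs , ys ⟫ ⟫ ⟫
  WVt k m ns = ⟪ lit 4 , ⟪ k , ⟪ m , ns ⟫ ⟫ ⟫

  SVt : ∀ {k} → Tm k → Tm k → Tm k → Tm k → Tm k
  SVt n xs i y = ⟪ lit 2 , ⟪ n , ⟪ xs , ⟪ i , y ⟫ ⟫ ⟫ ⟫

  WFt : ∀ {k} → Tm k → Tm k → Tm k
  WFt k n = ⟪ lit 3 , ⟪ k , n ⟫ ⟫

  precT : ∀ {k} → Tm k → Tm k → Tm k → Tm k
  precT k g h = ⟪ lit 5 , ⟪ k , ⟪ g , h ⟫ ⟫ ⟫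

  record Schema : Set where
    constructor schema
    field
      arity      : ℕ
      conclusion : Tm arity
      side       : Fm arity
      premises   : List (Tm arity)
  open Schema

  record Instance (s : Schema) (J S : ℕ) : Set where
    constructor inst
    field
      witnesses   : Vec ℕ (arity s)
      concludes   : J ≡ ev (conclusion s) witnesses
      side-holds  : holds (side s) witnesses
      premises-in : All (λ p → Mem S (ev p witnesses)) (premises s)

  -- The rules are numbered so that "some rule applies" is a finite disjunction.
  Rule : Set
  Rule = Fin 21

  pattern ev-zer      = zero
  pattern ev-succ     = suc ev-zer
  pattern ev-proj     = suc ev-succ
  pattern ev-orc      = suc ev-proj
  pattern ev-comp     = suc ev-orc
  pattern ev-prec0    = suc ev-comp
  pattern ev-precS    = suc ev-prec0
  pattern ev-mu       = suc ev-precS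
  pattern vec-nil     = suc ev-mu
  pattern vec-cons    = suc vec-nil
  pattern search-here = suc vec-cons
  pattern search-next = suc search-here
  pattern wf-zer      = suc search-next
  pattern wf-succ     = suc wf-zer
  pattern wf-orc      = suc wf-succ
  pattern wf-proj     = suc wf-orc
  pattern wf-comp     = suc wf-proj
  pattern wf-prec     = suc wf-comp
  pattern wf-mu       = suc wf-prec
  pattern wfv-nil     = suc wf-mu
  pattern wfv-cons    = suc wfv-nil

  rule : Rule → Schema
  rule ev-zer      = schema 1 (EVt ⟪ lit 0 , len₁ v0 ⟫ v0 (lit 0)) trueF []
  rule ev-succ     = schema 1 (EVt ⟪ lit 1 , lit 0 ⟫ ⟪ v0 , lit 0 ⟫ (lit 1 ⊕ v0)) trueF []
  rule ev-proj     = schema 2 (EVt ⟪ lit 2 , ⟪ len₁ v0 , v1 ⟫ ⟫ v0 (hd₁ (itl₂ v1 v0))) (ltF v1 (len₁ v0)) []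
  rule ev-orc      = schema 1 (EVt ⟪ lit 3 , lit 0 ⟫ ⟪ v0 , lit 0 ⟫ (lit 0)) trueF []
  rule ev-comp     = schema 5 (EVt ⟪ lit 4 , ⟪ len₁ v2 , ⟪ len₁ v4 , ⟪ v0 , v1 ⟫ ⟫ ⟫ ⟫ v2 v3) trueF
                       (VVt v1 v2 v4 ∷ EVt v0 v4 v3 ∷ [])
  rule ev-prec0    = schema 4 (EVt (precT (len₁ v2) v0 v1) ⟪ lit 0 , v2 ⟫ v3) trueF
                       (EVt v0 v2 v3 ∷ WFt (lit 2 ⊕ len₁ v2) v1 ∷ [])
  rule ev-precS    = schema 6 (EVt (precT (len₁ v2) v0 v1) ⟪ lit 1 ⊕ v4 , v2 ⟫ v3) trueF
                       (EVt (precT (len₁ v2) v0 v1) ⟪ v4 , v2 ⟫ v5 ∷ EVt v1 ⟪ v4 , ⟪ v5 , v2 ⟫ ⟫ v3 ∷ [])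
  rule ev-mu       = schema 3 (EVt ⟪ lit 6 , ⟪ len₁ v1 , v0 ⟫ ⟫ v1 v2) trueF (SVt v0 v1 (lit 0) v2 ∷ [])
  rule vec-nil     = schema 1 (VVt (lit 0) v0 (lit 0)) trueF []
  rule vec-cons    = schema 5 (VVt ⟪ v0 , v1 ⟫ v2 ⟪ v3 , v4 ⟫) trueF (EVt v0 v2 v3 ∷ VVt v1 v2 v4 ∷ [])
  rule search-here = schema 3 (SVt v0 v1 v2 v2) trueF (EVt v0 ⟪ v2 , v1 ⟫ (lit 0) ∷ [])
  rule search-next = schema 5 (SVt v0 v1 v2 v3) trueF
                       (EVt v0 ⟪ v2 , v1 ⟫ (lit 1 ⊕ v4) ∷ SVt v0 v1 (lit 1 ⊕ v2) v3 ∷ [])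
  rule wf-zer      = schema 1 (WFt v0 ⟪ lit 0 , v0 ⟫) trueF []
  rule wf-succ     = schema 0 (WFt (lit 1) ⟪ lit 1 , lit 0 ⟫) trueF []
  rule wf-orc      = schema 0 (WFt (lit 1) ⟪ lit 3 , lit 0 ⟫) trueF []
  rule wf-proj     = schema 2 (WFt v0 ⟪ lit 2 , ⟪ v0 , v1 ⟫ ⟫) (ltF v1 v0) []
  rule wf-comp     = schema 4 (WFt v0 ⟪ lit 4 , ⟪ v0 , ⟪ v1 , ⟪ v2 , v3 ⟫ ⟫ ⟫ ⟫) trueF
                       (WFt v1 v2 ∷ WVt v0 v1 v3 ∷ [])
  rule wf-prec     = schema 3 (WFt (lit 1 ⊕ v0) (precT v0 v1 v2)) trueF (WFt v0 v1 ∷ WFt (lit 2 ⊕ v0) v2 ∷ [])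
  rule wf-mu       = schema 2 (WFt v0 ⟪ lit 6 , ⟪ v0 , v1 ⟫ ⟫) trueF (WFt (lit 1 ⊕ v0) v1 ∷ [])
  rule wfv-nil     = schema 1 (WVt v0 (lit 0) (lit 0)) trueF []
  rule wfv-cons    = schema 4 (WVt v0 (lit 1 ⊕ v1) ⟪ v2 , v3 ⟫) trueF (WFt v0 v2 ∷ WVt v0 v1 v3 ∷ [])

  Just : ℕ → ℕ → Set
  Just J S = Σ Rule λ r → Instance (rule r) J S

  Just-mono : ∀ {J S S′} → (∀ {X} → Mem S X → Mem S′ X) → Just J S → Just J S′
  Just-mono S⊆S′ (r , inst ws eq sd ps) = r , inst ws eq sd (All.map S⊆S′ ps)

  -- A rule instance is expressed by a bounded formula because every witness occurs in the
  -- conclusion or in a premise, and is therefore at most J + S.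
  occurs : ∀ {k} → Fin k → Tm k → Bool
  occurs i (var j) = ⌊ i ≟ᶠ j ⌋
  occurs i (a ⊕ b) = occurs i a ∨ occurs i b
  occurs i ⟪ a , b ⟫ = occurs i a ∨ occurs i b
  occurs i _ = false

  occurs≤ : ∀ {k} i (t : Tm k) xs → T (occurs i t) → lookup xs i ≤ ev t xs
  occurs≤ i (var j) xs h rewrite toWitness h = ≤-refl
  occurs≤ i (a ⊕ b) xs h with Equivalence.to T-∨ h
  ... | inj₁ h′ = ≤-trans (occurs≤ i a xs h′) (m≤m+n _ _)
  ... | inj₂ h′ = ≤-trans (occurs≤ i b xs h′) (m≤n+m _ _)
  occurs≤ i ⟪ a , b ⟫ xs h with Equivalence.to T-∨ h
  ... | inj₁ h′ = ≤-trans (occurs≤ i a xs h′) (<⇒≤ (pair-fst< (ev a xs) (ev b xs)))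
  ... | inj₂ h′ = ≤-trans (occurs≤ i b xs h′) (<⇒≤ (pair-snd< (ev a xs) (ev b xs)))
  occurs≤ i (lit _) xs ()
  occurs≤ i (_ ⊛ _) xs ()
  occurs≤ i (_ ⊝ _) xs ()
  occurs≤ i (sub _ _) xs ()
  occurs≤ i (rc _ _ _) xs ()
  occurs≤ i (sm _ _) xs ()

  Mem⇒≤ : ∀ {S X} → Mem S X → X ≤ S
  Mem⇒≤ {S} (i , _ , _ , refl) = ≤-trans (hd≤ (itl i S)) (itl≤ i S)

  occurs-any : ∀ {k} → Fin k → List (Tm k) → Bool
  occurs-any i [] = false
  occurs-any i (p ∷ ps) = occurs i p ∨ occurs-any i ps

  occurs-premise≤ : ∀ {n} i (ps : List (Tm n)) ws S →
                    T (occurs-any i ps) → All (λ p → Mem S (ev p ws)) ps → lookup ws i ≤ S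
  occurs-premise≤ i (p ∷ ps) ws S h (m ∷ ms) with Equivalence.to T-∨ h
  ... | inj₁ h′ = ≤-trans (occurs≤ i p ws h′) (Mem⇒≤ m)
  ... | inj₂ h′ = occurs-premise≤ i ps ws S h′ ms

  everyFin : ∀ n → (Fin n → Bool) → Bool
  everyFin zero p = true
  everyFin (suc n) p = p zero ∧ everyFin n (p ∘ suc)

  everyFin-sound : ∀ n p → T (everyFin n p) → ∀ i → T (p i)
  everyFin-sound (suc n) p h zero = proj₁ (Equivalence.to T-∧ h)
  everyFin-sound (suc n) p h (suc i) = everyFin-sound n (p ∘ suc) (proj₂ (Equivalence.to T-∧ h)) i

  covered : Schema → Bool
  covered s = everyFin (arity s) λ i → occurs i (conclusion s) ∨ occurs-any i (premises s)

  rules-covered : ∀ r → T (covered (rule r))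
  rules-covered = everyFin-sound 21 (covered ∘ rule) tt

  witness-bound : ∀ s {J S} → T (covered s) → (I : Instance s J S) →
                  ∀ i → lookup (Instance.witnesses I) i < J + S + 1
  witness-bound s {S = S} cov (inst ws refl _ ps) i with Equivalence.to T-∨ (everyFin-sound (arity s) _ cov i)
  ... | inj₁ h = <-+1 (≤-trans (occurs≤ i (conclusion s) ws h) (m≤m+n _ S))
  ... | inj₂ h = <-+1 (≤-trans (occurs-premise≤ i (premises s) ws S h ps) (m≤n+m S _))

  premisesF : ∀ {n} → List (Tm n) → Fm (n + 2)
  premisesF [] = trueF
  premisesF {n} (p ∷ ps) = andF (memF (sub p (embedˡ 2)) (var (n ↑ʳ suc zero))) (premisesF ps)

  schemaF : Schema → Fm 2
  schemaF (schema n concl sd prems) =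
    exN n (v0 ⊕ v1 ⊕ lit 1)
      (andF (eqF (var (n ↑ʳ zero)) (sub concl (embedˡ 2))) (andF (subF sd (embedˡ 2)) (premisesF prems)))

  module _ {n} (ws : Vec ℕ n) (J S : ℕ) where

    private
      env : Vec ℕ (n + 2)
      env = ws ++ᵥ J ∷ S ∷ []

      ev-embed : ∀ (t : Tm n) → ev (sub t (embedˡ 2)) env ≡ ev t ws
      ev-embed t = cong (ev t) (evs-embedˡ ws (J ∷ S ∷ []))

    premisesF→ : ∀ ps → holds (premisesF ps) env → All (λ p → Mem S (ev p ws)) ps
    premisesF→ [] _ = []
    premisesF→ (p ∷ ps) (m , ms) = subst₂ Mem (lookup-++ʳ ws _ (suc zero)) (ev-embed p) m ∷ premisesF→ ps ms

    premisesF← : ∀ ps → All (λ p → Mem S (ev p ws)) ps → holds (premisesF ps) env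
    premisesF← [] _ = refl
    premisesF← (p ∷ ps) (m ∷ ms) =
      subst₂ Mem (sym (lookup-++ʳ ws _ (suc zero))) (sym (ev-embed p)) m , premisesF← ps ms

    schema-body→ : ∀ concl sd prems →
      holds (andF (eqF (var (n ↑ʳ zero)) (sub concl (embedˡ 2))) (andF (subF sd (embedˡ 2)) (premisesF prems))) env →
      Instance (schema n concl sd prems) J S
    schema-body→ concl sd prems (eqJ , sd′ , ps) =
      inst ws (trans (sym (lookup-++ʳ ws _ zero)) (trans eqJ (ev-embed concl)))
           (subst (holds sd) (evs-embedˡ ws _) sd′) (premisesF→ prems ps)

    schema-body← : ∀ concl sd prems → J ≡ ev concl ws → holds sd ws → All (λ p → Mem S (ev p ws)) prems →
      holds (andF (eqF (var (n ↑ʳ zero)) (sub concl (embedˡ 2))) (andF (subF sd (embedˡ 2)) (premisesF prems))) env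
    schema-body← concl sd prems eqJ sd′ ps =
      trans (lookup-++ʳ ws _ zero) (trans eqJ (sym (ev-embed concl))) ,
      subst (holds sd) (sym (evs-embedˡ ws _)) sd′ , premisesF← prems ps

  schemaF→ : ∀ s J S → holds (schemaF s) (J ∷ S ∷ []) → Instance s J S
  schemaF→ (schema n concl sd prems) J S h =
    let (ws , body) = exN→ n _ _ (J ∷ S ∷ []) h in schema-body→ ws J S concl sd prems body

  schemaF← : ∀ s J S → T (covered s) → Instance s J S → holds (schemaF s) (J ∷ S ∷ [])
  schemaF← s@(schema n concl sd prems) J S cov I@(inst ws eqJ sd′ ps) =
    exN← n _ _ (J ∷ S ∷ []) ws (witness-bound s cov I) (schema-body← ws J S concl sd prems eqJ sd′ ps)

  JustF : Fm 2
  JustF = anyF 21 (schemaF ∘ rule)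

  JustF→ : ∀ J S → holds JustF (J ∷ S ∷ []) → Just J S
  JustF→ J S h = let (r , h′) = anyF→ 21 (schemaF ∘ rule) (J ∷ S ∷ []) h in r , schemaF→ (rule r) J S h′

  JustF← : ∀ J S → Just J S → holds JustF (J ∷ S ∷ [])
  JustF← J S (r , I) = anyF← 21 (schemaF ∘ rule) (J ∷ S ∷ []) r (schemaF← (rule r) J S (rules-covered r) I)

  -- A derivation is a coded list in which every entry is justified by the entries after it.
  Valid : ℕ → Set
  Valid S = ∀ i → i < S → 0 < itl i S → Just (hd (itl i S)) (tl (itl i S))

  ValidF : Fm 1
  ValidF = allF v0 (impF (ltF (lit 0) (itl₂ v0 v1)) (subF JustF (hd₁ (itl₂ v0 v1) ∷ tl₁ (itl₂ v0 v1) ∷ [])))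

  ValidF→ : ∀ S → holds ValidF (S ∷ []) → Valid S
  ValidF→ S v i i<S p = JustF→ _ _ (v i i<S p)

  ValidF← : ∀ S → Valid S → holds ValidF (S ∷ [])
  ValidF← S v i i<S p = JustF← _ _ (v i i<S p)

  Valid-suffix : ∀ S i → Valid S → Valid (itl i S)
  Valid-suffix S i v j _ pos =
    subst (λ Z → Just (hd Z) (tl Z)) (sym (itl-+ j i S)) (v (j + i) (itl-pos (j + i) S pos′) pos′)
    where pos′ = subst (0 <_) (itl-+ j i S) pos

module Soundness where

  open Terms
  open TruthTerms
  open Pairing
  open SequenceCodes
  open BoundedFormulas
  open CodeInjectivity
  open Derivations

  SemE : ℕ → ℕ → ℕ → Set
  SemE n xs y = Σ ℕ λ k → Σ (Vec ℕ k) λ v → vc v ≡ xs × Σ (Code k) λ c → ⌜ c ⌝ ≡ n × Eval noOracle c v y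

  SemV : ℕ → ℕ → ℕ → Set
  SemV ns xs ys = Σ ℕ λ k → Σ ℕ λ m → Σ (Vec ℕ k) λ v → Σ (Vec ℕ m) λ w → vc v ≡ xs × vc w ≡ ys ×
    Σ (Vec (Code k) m) λ cs → ⌜ cs ⌝v ≡ ns × EvalVec noOracle cs v w

  SemS : ℕ → ℕ → ℕ → ℕ → Set
  SemS n xs i y = Σ ℕ λ k → Σ (Vec ℕ k) λ v → vc v ≡ xs × Σ (Code (suc k)) λ c → ⌜ c ⌝ ≡ n × Search noOracle c v i y

  SemW : ℕ → ℕ → Set
  SemW k n = Σ (Code k) λ c → ⌜ c ⌝ ≡ n

  SemWV : ℕ → ℕ → ℕ → Set
  SemWV k m ns = Σ (Vec (Code k) m) λ cs → ⌜ cs ⌝v ≡ ns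

  unpair₂ : ℕ → ℕ × ℕ
  unpair₂ p = hd p , tl p

  unpair₃ : ℕ → ℕ × ℕ × ℕ
  unpair₃ p = hd p , unpair₂ (tl p)

  unpair₄ : ℕ → ℕ × ℕ × ℕ × ℕ
  unpair₄ p = hd p , unpair₃ (tl p)

  unpair₂-⟨⟩ : ∀ a b → unpair₂ ⟨ a , b ⟩ ≡ (a , b)
  unpair₂-⟨⟩ a b = cong₂ _,_ (hd-pair a b) (tl-pair a b)

  unpair₃-⟨⟩ : ∀ a b c → unpair₃ ⟨ a , ⟨ b , c ⟩ ⟩ ≡ (a , b , c)
  unpair₃-⟨⟩ a b c = cong₂ _,_ (hd-pair a ⟨ b , c ⟩) (trans (cong unpair₂ (tl-pair a ⟨ b , c ⟩)) (unpair₂-⟨⟩ b c))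

  unpair₄-⟨⟩ : ∀ a b c d → unpair₄ ⟨ a , ⟨ b , ⟨ c , d ⟩ ⟩ ⟩ ≡ (a , b , c , d)
  unpair₄-⟨⟩ a b c d = cong₂ _,_ (hd-pair a ⟨ b , ⟨ c , d ⟩ ⟩) (trans (cong unpair₃ (tl-pair a ⟨ b , ⟨ c , d ⟩ ⟩)) (unpair₃-⟨⟩ b c d))

  SemE₃ SemV₃ SemWV₃ : ℕ × ℕ × ℕ → Set
  SemE₃ (n , xs , y) = SemE n xs y
  SemV₃ (ns , xs , ys) = SemV ns xs ys
  SemWV₃ (k , m , ns) = SemWV k m ns

  SemS₄ : ℕ × ℕ × ℕ × ℕ → Set
  SemS₄ (n , xs , i , y) = SemS n xs i y

  SemW₂ : ℕ × ℕ → Set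
  SemW₂ (k , n) = SemW k n

  -- The meaning of a judgment is read off its tag; codes with no tag mean nothing.
  Sem : ℕ → ℕ → Set
  Sem 0 p = SemE₃ (unpair₃ p)
  Sem 1 p = SemV₃ (unpair₃ p)
  Sem 2 p = SemS₄ (unpair₄ p)
  Sem 3 p = SemW₂ (unpair₂ p)
  Sem 4 p = SemWV₃ (unpair₃ p)
  Sem (suc (suc (suc (suc (suc _))))) _ = ⊥

  SemJ : ℕ → Set
  SemJ J = Sem (hd J) (tl J)

  SemJ-tag : ∀ t p → SemJ ⟨ t , p ⟩ ≡ Sem t p
  SemJ-tag t p = cong₂ Sem (hd-pair t p) (tl-pair t p)

  SemJ-EV : ∀ n xs y → SemJ (EVj n xs y) ≡ SemE n xs y
  SemJ-EV n xs y = trans (SemJ-tag 0 ⟨ n , ⟨ xs , y ⟩ ⟩) (cong SemE₃ (unpair₃-⟨⟩ n xs y))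

  SemJ-VV : ∀ ns xs ys → SemJ (VVj ns xs ys) ≡ SemV ns xs ys
  SemJ-VV ns xs ys = trans (SemJ-tag 1 ⟨ ns , ⟨ xs , ys ⟩ ⟩) (cong SemV₃ (unpair₃-⟨⟩ ns xs ys))

  SemJ-SV : ∀ n xs i y → SemJ (SVj n xs i y) ≡ SemS n xs i y
  SemJ-SV n xs i y = trans (SemJ-tag 2 ⟨ n , ⟨ xs , ⟨ i , y ⟩ ⟩ ⟩) (cong SemS₄ (unpair₄-⟨⟩ n xs i y))

  SemJ-WF : ∀ k n → SemJ (WFj k n) ≡ SemW k n
  SemJ-WF k n = trans (SemJ-tag 3 ⟨ k , n ⟩) (cong SemW₂ (unpair₂-⟨⟩ k n))

  SemJ-WV : ∀ k m ns → SemJ (WVj k m ns) ≡ SemWV k m ns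
  SemJ-WV k m ns = trans (SemJ-tag 4 ⟨ k , ⟨ m , ns ⟩ ⟩) (cong SemWV₃ (unpair₃-⟨⟩ k m ns))

  SemJ→E : ∀ n xs y → SemJ (EVj n xs y) → SemE n xs y
  SemJ→E n xs y = subst id (SemJ-EV n xs y)

  E→SemJ : ∀ n xs y → SemE n xs y → SemJ (EVj n xs y)
  E→SemJ n xs y = subst id (sym (SemJ-EV n xs y))

  SemJ→V : ∀ ns xs ys → SemJ (VVj ns xs ys) → SemV ns xs ys
  SemJ→V ns xs ys = subst id (SemJ-VV ns xs ys)

  V→SemJ : ∀ ns xs ys → SemV ns xs ys → SemJ (VVj ns xs ys)
  V→SemJ ns xs ys = subst id (sym (SemJ-VV ns xs ys))

  SemJ→S : ∀ n xs i y → SemJ (SVj n xs i y) → SemS n xs i y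
  SemJ→S n xs i y = subst id (SemJ-SV n xs i y)

  S→SemJ : ∀ n xs i y → SemS n xs i y → SemJ (SVj n xs i y)
  S→SemJ n xs i y = subst id (sym (SemJ-SV n xs i y))

  SemJ→W : ∀ k n → SemJ (WFj k n) → SemW k n
  SemJ→W k n = subst id (SemJ-WF k n)

  W→SemJ : ∀ k n → SemW k n → SemJ (WFj k n)
  W→SemJ k n = subst id (sym (SemJ-WF k n))

  SemJ→WV : ∀ k m ns → SemJ (WVj k m ns) → SemWV k m ns
  SemJ→WV k m ns = subst id (SemJ-WV k m ns)

  WV→SemJ : ∀ k m ns → SemWV k m ns → SemJ (WVj k m ns)
  WV→SemJ k m ns = subst id (sym (SemJ-WV k m ns))

  vc-surj : ∀ S → Σ ℕ λ k → Σ (Vec ℕ k) λ v → vc v ≡ S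
  vc-surj = <-rec (λ S → Σ ℕ λ k → Σ (Vec ℕ k) λ v → vc v ≡ S) step
    where
    step : ∀ S → (∀ {T} → T < S → Σ ℕ λ k → Σ (Vec ℕ k) λ v → vc v ≡ T) → Σ ℕ λ k → Σ (Vec ℕ k) λ v → vc v ≡ S
    step zero _ = 0 , [] , refl
    step (suc S) ih with pair-surj (suc S) (s≤s z≤n)
    ... | a , b , e with ih (subst (b <_) e (pair-snd< a b))
    ... | k , v , refl = suc k , a ∷ v , e

  data VecCons : ∀ {k} → Vec ℕ k → ℕ → ℕ → Set where
    cons : ∀ {k} a (w : Vec ℕ k) {b} → vc w ≡ b → VecCons (a ∷ w) a b

  vc-cons : ∀ {k} (v : Vec ℕ k) a b → vc v ≡ ⟨ a , b ⟩ → VecCons v a b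
  vc-cons [] a b e = ⊥-elim (<-irrefl e (pair-pos a b))
  vc-cons (x ∷ v) a b e with pair-inj x (vc v) a b e
  ... | refl , e′ = cons x v e′

  tag-clash : ∀ t a s b → t ≢ s → ⟨ t , a ⟩ ≢ ⟨ s , b ⟩
  tag-clash t a s b t≢s e = t≢s (proj₁ (pair-inj t a s b e))

  prec-inv : ∀ {k} (c : Code (suc k)) k′ g h → ⌜ c ⌝ ≡ ⟨ 5 , ⟨ k′ , ⟨ g , h ⟩ ⟩ ⟩ →
    Σ (Code k) λ g′ → Σ (Code (suc (suc k))) λ h′ → c ≡ prec g′ h′ × ⌜ g′ ⌝ ≡ g × ⌜ h′ ⌝ ≡ h
  prec-inv {k} (prec g′ h′) k′ g h e = prec-match (pair-inj ⌜ g′ ⌝ ⌜ h′ ⌝ g h e₂)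
    where
    e₁ : ⟨ k , ⟨ ⌜ g′ ⌝ , ⌜ h′ ⌝ ⟩ ⟩ ≡ ⟨ k′ , ⟨ g , h ⟩ ⟩
    e₁ = proj₂ (pair-inj 5 ⟨ k , ⟨ ⌜ g′ ⌝ , ⌜ h′ ⌝ ⟩ ⟩ 5 ⟨ k′ , ⟨ g , h ⟩ ⟩ e)
    e₂ : ⟨ ⌜ g′ ⌝ , ⌜ h′ ⌝ ⟩ ≡ ⟨ g , h ⟩
    e₂ = proj₂ (pair-inj k ⟨ ⌜ g′ ⌝ , ⌜ h′ ⌝ ⟩ k′ ⟨ g , h ⟩ e₁)
    prec-match : ⌜ g′ ⌝ ≡ g × ⌜ h′ ⌝ ≡ h →
                 Σ (Code k) λ g″ → Σ (Code (suc (suc k))) λ h″ → prec g′ h′ ≡ prec g″ h″ × ⌜ g″ ⌝ ≡ g × ⌜ h″ ⌝ ≡ h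
    prec-match (p , q) = g′ , h′ , refl , p , q
  prec-inv {k} zer k′ g h e = ⊥-elim (tag-clash 0 (suc k) 5 ⟨ k′ , ⟨ g , h ⟩ ⟩ (λ ()) e)
  prec-inv succ k′ g h e = ⊥-elim (tag-clash 1 0 5 ⟨ k′ , ⟨ g , h ⟩ ⟩ (λ ()) e)
  prec-inv {k} (proj i) k′ g h e = ⊥-elim (tag-clash 2 ⟨ suc k , toℕ i ⟩ 5 ⟨ k′ , ⟨ g , h ⟩ ⟩ (λ ()) e)
  prec-inv orc k′ g h e = ⊥-elim (tag-clash 3 0 5 ⟨ k′ , ⟨ g , h ⟩ ⟩ (λ ()) e)
  prec-inv {k} (comp {m = m} c cs) k′ g h e =
    ⊥-elim (tag-clash 4 ⟨ suc k , ⟨ m , ⟨ ⌜ c ⌝ , ⌜ cs ⌝v ⟩ ⟩ ⟩ 5 ⟨ k′ , ⟨ g , h ⟩ ⟩ (λ ()) e)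
  prec-inv {k} (mu c) k′ g h e = ⊥-elim (tag-clash 6 ⟨ suc k , ⌜ c ⌝ ⟩ 5 ⟨ k′ , ⟨ g , h ⟩ ⟩ (λ ()) e)

  zer-sound : ∀ xs → SemE ⟨ 0 , len xs ⟩ xs 0
  zer-sound xs with vc-surj xs
  ... | k , v , refl = k , v , refl , zer , cong (λ z → ⟨ 0 , z ⟩) (sym (len-vc v)) , e-zer

  proj-sound : ∀ xs i → i < len xs → SemE ⟨ 2 , ⟨ len xs , i ⟩ ⟩ xs (nth xs i)
  proj-sound xs i i<len with vc-surj xs
  ... | k , v , refl = k , v , refl , proj (fromℕ< i<k) ,
          cong (λ z → ⟨ 2 , z ⟩) (cong₂ ⟨_,_⟩ (sym (len-vc v)) (toℕ-fromℕ< i<k)) ,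
          subst (Eval noOracle (proj (fromℕ< i<k)) v)
                (trans (sym (nth-vc v (fromℕ< i<k))) (cong (nth (vc v)) (toℕ-fromℕ< i<k))) e-proj
    where i<k = subst (i <_) (len-vc v) i<len

  comp-sound : ∀ {c cs xs y ys} → SemV cs xs ys → SemE c ys y →
               SemE ⟨ 4 , ⟨ len xs , ⟨ len ys , ⟨ c , cs ⟩ ⟩ ⟩ ⟩ xs y
  comp-sound (k , m , v , w , refl , refl , cs , refl , evv) (_ , w′ , e , c , refl , ev) with vc-inj w′ w e
  ... | refl , refl = k , v , refl , comp c cs ,
          cong (λ z → ⟨ 4 , z ⟩) (cong₂ ⟨_,_⟩ (sym (len-vc v)) (cong (λ z → ⟨ z , ⟨ ⌜ c ⌝ , ⌜ cs ⌝v ⟩ ⟩) (sym (len-vc w)))) ,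
          e-comp evv ev

  prec0-sound : ∀ {g h xs y} → SemE g xs y → SemW (2 + len xs) h →
                SemE ⟨ 5 , ⟨ len xs , ⟨ g , h ⟩ ⟩ ⟩ ⟨ 0 , xs ⟩ y
  prec0-sound (k , v , refl , g , refl , evg) hw with len (vc v) | len-vc v
  prec0-sound (k , v , refl , g , refl , evg) (h , refl) | .k | refl = suc k , 0 ∷ v , refl , prec g h , refl , e-prec0 evg

  precS-sound : ∀ g h xs y n r → SemE ⟨ 5 , ⟨ len xs , ⟨ g , h ⟩ ⟩ ⟩ ⟨ n , xs ⟩ r → SemE h ⟨ n , ⟨ r , xs ⟩ ⟩ y →
                SemE ⟨ 5 , ⟨ len xs , ⟨ g , h ⟩ ⟩ ⟩ ⟨ 1 + n , xs ⟩ y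
  precS-sound g h xs y n r (_ , v₁ , e₁ , c₁ , ec₁ , ev₁) (_ , v₂ , e₂ , c₂ , ec₂ , ev₂)
    with vc-cons v₁ n xs e₁
  ... | cons .n w refl with prec-inv c₁ (len (vc w)) g h ec₁
  ... | g′ , h′ , refl , refl , refl with vc-cons v₂ n ⟨ r , vc w ⟩ e₂
  ... | cons .n w₂ e₂′ with vc-cons w₂ r (vc w) e₂′
  ... | cons .r w₃ e₃ with vc-inj w₃ w e₃
  ... | refl , refl with code-inj c₂ h′ ec₂
  ... | refl = _ , suc n ∷ w , refl , prec g′ h′ , ec₁ , e-precS ev₁ ev₂

  mu-sound : ∀ {c xs y} → SemS c xs 0 y → SemE ⟨ 6 , ⟨ len xs , c ⟩ ⟩ xs y
  mu-sound (k , v , refl , c , refl , s) =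
    k , v , refl , mu c , cong (λ z → ⟨ 6 , ⟨ z , ⌜ c ⌝ ⟩ ⟩) (sym (len-vc v)) , e-mu s

  vnil-sound : ∀ xs → SemV 0 xs 0
  vnil-sound xs with vc-surj xs
  ... | k , v , refl = k , 0 , v , [] , refl , refl , [] , refl , ev-[]

  vcons-sound : ∀ {c cs xs y ys} → SemE c xs y → SemV cs xs ys → SemV ⟨ c , cs ⟩ xs ⟨ y , ys ⟩
  vcons-sound {y = y} (k , v , refl , c , refl , ev) (_ , m , v′ , w , e , refl , cs , refl , evv) with vc-inj v′ v e
  ... | refl , refl = k , suc m , v , y ∷ w , refl , refl , c ∷ cs , refl , ev-∷ ev evv

  here-sound : ∀ {c xs i} → SemE c ⟨ i , xs ⟩ 0 → SemS c xs i i
  here-sound {xs = xs} {i} (_ , v , e , c , refl , ev) with vc-cons v i xs e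
  ... | cons .i w refl = _ , w , refl , c , refl , s-here ev

  next-sound : ∀ {c xs i y m} → SemE c ⟨ i , xs ⟩ (1 + m) → SemS c xs (1 + i) y → SemS c xs i y
  next-sound {xs = xs} {i} (_ , v , e , c , refl , ev) (_ , v′ , e′ , c′ , ec′ , s) with vc-cons v i xs e
  ... | cons .i w refl with vc-inj v′ w e′
  ... | refl , refl with code-inj c′ c ec′
  ... | refl = _ , w , refl , c , refl , s-next ev s

  proj-wf : ∀ {k i} → i < k → SemW k ⟨ 2 , ⟨ k , i ⟩ ⟩
  proj-wf {k} i<k = proj (fromℕ< i<k) , cong (λ z → ⟨ 2 , ⟨ k , z ⟩ ⟩) (toℕ-fromℕ< i<k)

  comp-wf : ∀ {k m c cs} → SemW m c → SemWV k m cs → SemW k ⟨ 4 , ⟨ k , ⟨ m , ⟨ c , cs ⟩ ⟩ ⟩ ⟩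
  comp-wf (c , refl) (cs , refl) = comp c cs , refl

  prec-wf : ∀ {k g h} → SemW k g → SemW (2 + k) h → SemW (1 + k) ⟨ 5 , ⟨ k , ⟨ g , h ⟩ ⟩ ⟩
  prec-wf (g , refl) (h , refl) = prec g h , refl

  mu-wf : ∀ {k c} → SemW (1 + k) c → SemW k ⟨ 6 , ⟨ k , c ⟩ ⟩
  mu-wf (c , refl) = mu c , refl

  cons-wfv : ∀ {k m c cs} → SemW k c → SemWV k m cs → SemWV k (1 + m) ⟨ c , cs ⟩
  cons-wfv (c , refl) (cs , refl) = c ∷ cs , refl

  -- The judgments are spelled out below: leaving them to unification makes it unfold the pairing.
  rule-sound : ∀ r {J S} → Instance (rule r) J S → (∀ {X} → Mem S X → SemJ X) → SemJ J
  rule-sound ev-zer (inst (xs ∷ []) refl _ []) _ = E→SemJ ⟨ 0 , len xs ⟩ xs 0 (zer-sound xs)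
  rule-sound ev-succ (inst (x ∷ []) refl _ []) _ =
    E→SemJ ⟨ 1 , 0 ⟩ ⟨ x , 0 ⟩ (suc x) (1 , x ∷ [] , refl , succ , refl , e-succ)
  rule-sound ev-proj (inst (xs ∷ i ∷ []) refl i<len []) _ =
    E→SemJ ⟨ 2 , ⟨ len xs , i ⟩ ⟩ xs (nth xs i) (proj-sound xs i i<len)
  rule-sound ev-orc (inst (x ∷ []) refl _ []) _ = E→SemJ ⟨ 3 , 0 ⟩ ⟨ x , 0 ⟩ 0 (1 , x ∷ [] , refl , orc , refl , e-orc)
  rule-sound ev-comp (inst (c ∷ cs ∷ xs ∷ y ∷ ys ∷ []) refl _ (m₁ ∷ m₂ ∷ [])) ih =
    E→SemJ ⟨ 4 , ⟨ len xs , ⟨ len ys , ⟨ c , cs ⟩ ⟩ ⟩ ⟩ xs y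
      (comp-sound (SemJ→V cs xs ys (ih m₁)) (SemJ→E c ys y (ih m₂)))
  rule-sound ev-prec0 (inst (g ∷ h ∷ xs ∷ y ∷ []) refl _ (m₁ ∷ m₂ ∷ [])) ih =
    E→SemJ ⟨ 5 , ⟨ len xs , ⟨ g , h ⟩ ⟩ ⟩ ⟨ 0 , xs ⟩ y
      (prec0-sound (SemJ→E g xs y (ih m₁)) (SemJ→W (2 + len xs) h (ih m₂)))
  rule-sound ev-precS (inst (g ∷ h ∷ xs ∷ y ∷ n ∷ r ∷ []) refl _ (m₁ ∷ m₂ ∷ [])) ih =
    E→SemJ ⟨ 5 , ⟨ len xs , ⟨ g , h ⟩ ⟩ ⟩ ⟨ 1 + n , xs ⟩ y
      (precS-sound g h xs y n r (SemJ→E ⟨ 5 , ⟨ len xs , ⟨ g , h ⟩ ⟩ ⟩ ⟨ n , xs ⟩ r (ih m₁)) (SemJ→E h ⟨ n , ⟨ r , xs ⟩ ⟩ y (ih m₂)))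
  rule-sound ev-mu (inst (c ∷ xs ∷ y ∷ []) refl _ (m ∷ [])) ih =
    E→SemJ ⟨ 6 , ⟨ len xs , c ⟩ ⟩ xs y (mu-sound (SemJ→S c xs 0 y (ih m)))
  rule-sound vec-nil (inst (xs ∷ []) refl _ []) _ = V→SemJ 0 xs 0 (vnil-sound xs)
  rule-sound vec-cons (inst (c ∷ cs ∷ xs ∷ y ∷ ys ∷ []) refl _ (m₁ ∷ m₂ ∷ [])) ih =
    V→SemJ ⟨ c , cs ⟩ xs ⟨ y , ys ⟩ (vcons-sound (SemJ→E c xs y (ih m₁)) (SemJ→V cs xs ys (ih m₂)))
  rule-sound search-here (inst (c ∷ xs ∷ i ∷ []) refl _ (m ∷ [])) ih =
    S→SemJ c xs i i (here-sound (SemJ→E c ⟨ i , xs ⟩ 0 (ih m)))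
  rule-sound search-next (inst (c ∷ xs ∷ i ∷ y ∷ m ∷ []) refl _ (m₁ ∷ m₂ ∷ [])) ih =
    S→SemJ c xs i y (next-sound (SemJ→E c ⟨ i , xs ⟩ (1 + m) (ih m₁)) (SemJ→S c xs (1 + i) y (ih m₂)))
  rule-sound wf-zer (inst (k ∷ []) refl _ []) _ = W→SemJ k ⟨ 0 , k ⟩ (zer , refl)
  rule-sound wf-succ (inst [] refl _ []) _ = W→SemJ 1 ⟨ 1 , 0 ⟩ (succ , refl)
  rule-sound wf-orc (inst [] refl _ []) _ = W→SemJ 1 ⟨ 3 , 0 ⟩ (orc , refl)
  rule-sound wf-proj (inst (k ∷ i ∷ []) refl i<k []) _ = W→SemJ k ⟨ 2 , ⟨ k , i ⟩ ⟩ (proj-wf i<k)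
  rule-sound wf-comp (inst (k ∷ m ∷ c ∷ cs ∷ []) refl _ (m₁ ∷ m₂ ∷ [])) ih =
    W→SemJ k ⟨ 4 , ⟨ k , ⟨ m , ⟨ c , cs ⟩ ⟩ ⟩ ⟩ (comp-wf (SemJ→W m c (ih m₁)) (SemJ→WV k m cs (ih m₂)))
  rule-sound wf-prec (inst (k ∷ g ∷ h ∷ []) refl _ (m₁ ∷ m₂ ∷ [])) ih =
    W→SemJ (1 + k) ⟨ 5 , ⟨ k , ⟨ g , h ⟩ ⟩ ⟩ (prec-wf (SemJ→W k g (ih m₁)) (SemJ→W (2 + k) h (ih m₂)))
  rule-sound wf-mu (inst (k ∷ c ∷ []) refl _ (m ∷ [])) ih =
    W→SemJ k ⟨ 6 , ⟨ k , c ⟩ ⟩ (mu-wf (SemJ→W (1 + k) c (ih m)))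
  rule-sound wfv-nil (inst (k ∷ []) refl _ []) _ = WV→SemJ k 0 0 ([] , refl)
  rule-sound wfv-cons (inst (k ∷ m ∷ c ∷ cs ∷ []) refl _ (m₁ ∷ m₂ ∷ [])) ih =
    WV→SemJ k (1 + m) ⟨ c , cs ⟩ (cons-wfv (SemJ→W k c (ih m₁)) (SemJ→WV k m cs (ih m₂)))

  sound : ∀ S → Valid S → ∀ {X} → Mem S X → SemJ X
  sound = <-rec (λ S → Valid S → ∀ {X} → Mem S X → SemJ X) step
    where
    step : ∀ S → (∀ {T} → T < S → Valid T → ∀ {X} → Mem T X → SemJ X) → Valid S → ∀ {X} → Mem S X → SemJ X
    step S ih v (i , i<S , pos , refl) =
      let (r , I) = v i i<S pos in
      rule-sound r I (ih (<-≤-trans (tl< (itl i S) pos) (itl≤ i S))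
                         (subst Valid (itl-step i S) (Valid-suffix S (suc i) v)))


module Completeness where

  open Terms
  open TruthTerms
  open Pairing
  open SequenceCodes
  open BoundedFormulas
  open Derivations

  lc : List ℕ → ℕ
  lc [] = 0
  lc (x ∷ L) = ⟨ x , lc L ⟩

  itl-lc : ∀ i L → itl i (lc L) ≡ lc (drop i L)
  itl-lc zero L = itl0 (lc L)
  itl-lc (suc i) [] = itl-zero (suc i)
  itl-lc (suc i) (x ∷ L) = trans (itl-pair i x (lc L)) (itl-lc i L)

  drop-++ˡ : ∀ i (L₁ L₂ : List ℕ) X R → drop i L₁ ≡ X ∷ R → drop i (L₁ ++ L₂) ≡ X ∷ (R ++ L₂)
  drop-++ˡ zero L₁ L₂ X R refl = refl
  drop-++ˡ (suc i) (x ∷ L₁) L₂ X R e = drop-++ˡ i L₁ L₂ X R e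

  drop-++ʳ : ∀ (L₁ L₂ : List ℕ) i → drop (length L₁ + i) (L₁ ++ L₂) ≡ drop i L₂
  drop-++ʳ [] L₂ i = refl
  drop-++ʳ (x ∷ L₁) L₂ i = drop-++ʳ L₁ L₂ i

  mem-from : ∀ i (L : List ℕ) X R → drop i L ≡ X ∷ R → Mem (lc L) X
  mem-from i L X R e = i , itl-pos i (lc L) pos , pos , trans (cong hd eq) (hd-pair X (lc R))
    where
    eq : itl i (lc L) ≡ ⟨ X , lc R ⟩
    eq = trans (itl-lc i L) (cong lc e)
    pos : 0 < itl i (lc L)
    pos = subst (0 <_) (sym eq) (pair-pos X (lc R))

  mem-to : ∀ (L : List ℕ) X → Mem (lc L) X → Σ ℕ λ i → Σ (List ℕ) λ R → drop i L ≡ X ∷ R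
  mem-to L X (i , _ , pos , refl) with drop i L in e
  ... | [] = ⊥-elim (<-irrefl (sym (trans (itl-lc i L) (cong lc e))) pos)
  ... | Y ∷ R = i , R , trans e (cong (_∷ R) (sym (trans (cong hd (trans (itl-lc i L) (cong lc e))) (hd-pair Y (lc R)))))

  mem-head : ∀ X L → Mem (lc (X ∷ L)) X
  mem-head X L = mem-from 0 (X ∷ L) X L refl

  mem-++ˡ : ∀ L₁ L₂ {X} → Mem (lc L₁) X → Mem (lc (L₁ ++ L₂)) X
  mem-++ˡ L₁ L₂ {X} m = let (i , R , e) = mem-to L₁ X m in mem-from i (L₁ ++ L₂) X (R ++ L₂) (drop-++ˡ i L₁ L₂ X R e)

  mem-++ʳ : ∀ L₁ L₂ {X} → Mem (lc L₂) X → Mem (lc (L₁ ++ L₂)) X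
  mem-++ʳ L₁ L₂ {X} m = let (i , R , e) = mem-to L₂ X m in mem-from (length L₁ + i) (L₁ ++ L₂) X R (trans (drop-++ʳ L₁ L₂ i) e)

  ValidL : List ℕ → Set
  ValidL [] = ⊤
  ValidL (J ∷ L) = Just J (lc L) × ValidL L

  ValidL-drop : ∀ i L → ValidL L → ValidL (drop i L)
  ValidL-drop zero L v = v
  ValidL-drop (suc i) [] v = tt
  ValidL-drop (suc i) (x ∷ L) (_ , v) = ValidL-drop i L v

  ValidL⇒Valid : ∀ L → ValidL L → Valid (lc L)
  ValidL⇒Valid L v i _ pos with drop i L in e | ValidL-drop i L v
  ... | [] | _ = ⊥-elim (<-irrefl (sym (trans (itl-lc i L) (cong lc e))) pos)
  ... | J ∷ R | (j , _) = subst (λ Z → Just (hd Z) (tl Z)) (sym (trans (itl-lc i L) (cong lc e)))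
                             (subst₂ Just (sym (hd-pair J (lc R))) (sym (tl-pair J (lc R))) j)

  ValidL-++ : ∀ L₁ L₂ → ValidL L₁ → ValidL L₂ → ValidL (L₁ ++ L₂)
  ValidL-++ [] L₂ _ v₂ = v₂
  ValidL-++ (J ∷ L₁) L₂ (j , v₁) v₂ = Just-mono (mem-++ˡ L₁ L₂) j , ValidL-++ L₁ L₂ v₁ v₂

  Der : ℕ → Set
  Der J = Σ (List ℕ) λ L → ValidL (J ∷ L)

  derivations-++ : ∀ Ps → All Der Ps → Σ (List ℕ) λ L → ValidL L × All (Mem (lc L)) Ps
  derivations-++ [] [] = [] , tt , []
  derivations-++ (P ∷ Ps) ((L₁ , v₁) ∷ ds) =
    let (L₂ , v₂ , ms) = derivations-++ Ps ds in
    (P ∷ L₁) ++ L₂ , ValidL-++ (P ∷ L₁) L₂ v₁ v₂ ,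
    mem-++ˡ (P ∷ L₁) L₂ (mem-head P L₁) ∷ All.map (mem-++ʳ (P ∷ L₁) L₂) ms

  derive : ∀ {J} Ps → All Der Ps → (∀ {S} → All (Mem S) Ps → Just J S) → Der J
  derive Ps ds j = let (L , v , ms) = derivations-++ Ps ds in L , j ms , v

  mutual
    derive-ev : ∀ {k} {c : Code k} {v : Vec ℕ k} {y} → Eval noOracle c v y → Der (EVj ⌜ c ⌝ (vc v) y)
    derive-ev (e-zer {xs = xs}) = derive [] [] λ _ →
      ev-zer , inst (vc xs ∷ []) (cong (λ z → EVj ⟨ 0 , z ⟩ (vc xs) 0) (sym (len-vc xs))) refl []
    derive-ev (e-succ {x}) = derive [] [] λ _ → ev-succ , inst (x ∷ []) refl refl []
    derive-ev (e-proj {i = i} {xs}) = derive [] [] λ _ →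
      ev-proj , inst (vc xs ∷ toℕ i ∷ [])
                     (cong₂ (λ a b → EVj ⟨ 2 , ⟨ a , toℕ i ⟩ ⟩ (vc xs) b) (sym (len-vc xs)) (sym (nth-vc xs i)))
                     (subst (toℕ i <_) (sym (len-vc xs)) (toℕ<n i)) []
    derive-ev (e-orc {x}) = derive [] [] λ _ → ev-orc , inst (x ∷ []) refl refl []
    derive-ev (e-comp {c = c} {cs} {xs} {ys} {y} evv ev) =
      derive _ (derive-vec evv ∷ derive-ev ev ∷ []) λ { (m₁ ∷ m₂ ∷ []) →
        ev-comp , inst (⌜ c ⌝ ∷ ⌜ cs ⌝v ∷ vc xs ∷ y ∷ vc ys ∷ [])
          (cong₂ (λ a b → EVj ⟨ 4 , ⟨ a , ⟨ b , ⟨ ⌜ c ⌝ , ⌜ cs ⌝v ⟩ ⟩ ⟩ ⟩ (vc xs) y) (sym (len-vc xs)) (sym (len-vc ys)))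
          refl (m₁ ∷ m₂ ∷ []) }
    derive-ev (e-prec0 {g = g} {h} {xs} {y} ev) =
      derive _ (derive-ev ev ∷ derive-wf h ∷ []) λ { (m₁ ∷ m₂ ∷ []) →
        ev-prec0 , inst (⌜ g ⌝ ∷ ⌜ h ⌝ ∷ vc xs ∷ y ∷ [])
          (cong (λ z → EVj ⟨ 5 , ⟨ z , ⟨ ⌜ g ⌝ , ⌜ h ⌝ ⟩ ⟩ ⟩ ⟨ 0 , vc xs ⟩ y) (sym (len-vc xs)))
          refl (m₁ ∷ subst (λ z → Mem _ (WFj (2 + z) ⌜ h ⌝)) (sym (len-vc xs)) m₂ ∷ []) }
    derive-ev (e-precS {g = g} {h} {n} {xs} {r} {y} ev₁ ev₂) =
      derive _ (derive-ev ev₁ ∷ derive-ev ev₂ ∷ []) λ { (m₁ ∷ m₂ ∷ []) →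
        ev-precS , inst (⌜ g ⌝ ∷ ⌜ h ⌝ ∷ vc xs ∷ y ∷ n ∷ r ∷ [])
          (cong (λ z → EVj ⟨ 5 , ⟨ z , ⟨ ⌜ g ⌝ , ⌜ h ⌝ ⟩ ⟩ ⟩ ⟨ suc n , vc xs ⟩ y) (sym (len-vc xs)))
          refl (subst (λ z → Mem _ (EVj ⟨ 5 , ⟨ z , ⟨ ⌜ g ⌝ , ⌜ h ⌝ ⟩ ⟩ ⟩ ⟨ n , vc xs ⟩ r)) (sym (len-vc xs)) m₁ ∷ m₂ ∷ []) }
    derive-ev (e-mu {c = c} {xs} {y} s) =
      derive _ (derive-search s ∷ []) λ { (m ∷ []) →
        ev-mu , inst (⌜ c ⌝ ∷ vc xs ∷ y ∷ []) (cong (λ z → EVj ⟨ 6 , ⟨ z , ⌜ c ⌝ ⟩ ⟩ (vc xs) y) (sym (len-vc xs))) refl (m ∷ []) }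

    derive-vec : ∀ {k m} {cs : Vec (Code k) m} {v w} → EvalVec noOracle cs v w → Der (VVj ⌜ cs ⌝v (vc v) (vc w))
    derive-vec (ev-[] {xs}) = derive [] [] λ _ → vec-nil , inst (vc xs ∷ []) refl refl []
    derive-vec (ev-∷ {c = c} {cs} {xs} {y} {ys} ev evv) =
      derive _ (derive-ev ev ∷ derive-vec evv ∷ []) λ { (m₁ ∷ m₂ ∷ []) →
        vec-cons , inst (⌜ c ⌝ ∷ ⌜ cs ⌝v ∷ vc xs ∷ y ∷ vc ys ∷ []) refl refl (m₁ ∷ m₂ ∷ []) }

    derive-search : ∀ {k} {c : Code (suc k)} {v i y} → Search noOracle c v i y → Der (SVj ⌜ c ⌝ (vc v) i y)
    derive-search {c = c} {v} (s-here {i} ev) =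
      derive _ (derive-ev ev ∷ []) λ { (m ∷ []) → search-here , inst (⌜ c ⌝ ∷ vc v ∷ i ∷ []) refl refl (m ∷ []) }
    derive-search {c = c} {v} (s-next {i} {m} {y} ev s) =
      derive _ (derive-ev ev ∷ derive-search s ∷ []) λ { (m₁ ∷ m₂ ∷ []) →
        search-next , inst (⌜ c ⌝ ∷ vc v ∷ i ∷ y ∷ m ∷ []) refl refl (m₁ ∷ m₂ ∷ []) }

    derive-wf : ∀ {k} (c : Code k) → Der (WFj k ⌜ c ⌝)
    derive-wf (zer {k}) = derive [] [] λ _ → wf-zer , inst (k ∷ []) refl refl []
    derive-wf succ = derive [] [] λ _ → wf-succ , inst [] refl refl []
    derive-wf orc = derive [] [] λ _ → wf-orc , inst [] refl refl []
    derive-wf (proj {k} i) = derive [] [] λ _ → wf-proj , inst (k ∷ toℕ i ∷ []) refl (toℕ<n i) []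
    derive-wf (comp {k} {m} c cs) =
      derive _ (derive-wf c ∷ derive-wfv cs ∷ []) λ { (m₁ ∷ m₂ ∷ []) →
        wf-comp , inst (k ∷ m ∷ ⌜ c ⌝ ∷ ⌜ cs ⌝v ∷ []) refl refl (m₁ ∷ m₂ ∷ []) }
    derive-wf (prec {k} g h) =
      derive _ (derive-wf g ∷ derive-wf h ∷ []) λ { (m₁ ∷ m₂ ∷ []) →
        wf-prec , inst (k ∷ ⌜ g ⌝ ∷ ⌜ h ⌝ ∷ []) refl refl (m₁ ∷ m₂ ∷ []) }
    derive-wf (mu {k} c) =
      derive _ (derive-wf c ∷ []) λ { (m ∷ []) → wf-mu , inst (k ∷ ⌜ c ⌝ ∷ []) refl refl (m ∷ []) }

    derive-wfv : ∀ {k m} (cs : Vec (Code k) m) → Der (WVj k m ⌜ cs ⌝v)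
    derive-wfv {k} [] = derive [] [] λ _ → wfv-nil , inst (k ∷ []) refl refl []
    derive-wfv {k} {suc m} (c ∷ cs) =
      derive _ (derive-wf c ∷ derive-wfv cs ∷ []) λ { (m₁ ∷ m₂ ∷ []) →
        wfv-cons , inst (k ∷ m ∷ ⌜ c ⌝ ∷ ⌜ cs ⌝v ∷ []) refl refl (m₁ ∷ m₂ ∷ []) }


module HaltingNormalForm where

  open Terms
  open TruthTerms
  open Pairing
  open SequenceCodes
  open BoundedFormulas
  open Derivations
  open Soundness
  open Completeness

  HaltsWithin : ℕ → ℕ → Set
  HaltsWithin e s = Σ ℕ λ S → S < s × Valid S × Σ ℕ λ y → y < S + 1 × Mem S (EVj e (vc (e ∷ [])) y)

  HaltsWithinF : Fm 2
  HaltsWithinF = exF v1 (andF (subF ValidF (v0 ∷ [])) (exF (v0 ⊕ lit 1) (memF (EVt v2 ⟪ v2 , lit 0 ⟫ v0) v1)))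

  HaltsWithinF→ : ∀ e s → holds HaltsWithinF (e ∷ s ∷ []) → HaltsWithin e s
  HaltsWithinF→ e s (S , S<s , v , y , y< , m) = S , S<s , ValidF→ S v , y , y< , m

  HaltsWithinF← : ∀ e s → HaltsWithin e s → holds HaltsWithinF (e ∷ s ∷ [])
  HaltsWithinF← e s (S , S<s , v , y , y< , m) = S , S<s , ValidF← S v , y , y< , m

  HaltsWithin-mono : ∀ e {s s′} → s ≤ s′ → HaltsWithin e s → HaltsWithin e s′
  HaltsWithin-mono e s≤s′ (S , S<s , rest) = S , <-≤-trans S<s s≤s′ , rest

  halting⇒haltsWithin : ∀ e → Halting e → Σ ℕ (HaltsWithin e)
  halting⇒haltsWithin e (c , refl , y , ev) with derive-ev ev
  ... | L , v = suc (lc (halts ∷ L)) , lc (halts ∷ L) , ≤-refl , ValidL⇒Valid (halts ∷ L) v , y , <-+1 y≤lc ,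
                mem-head halts L
    where
    input halts : ℕ
    input = vc (⌜ c ⌝ ∷ [])
    halts = EVj ⌜ c ⌝ input y
    y≤lc : y ≤ lc (halts ∷ L)
    y≤lc = <⇒≤ (<-trans (pair-snd< input y) (<-trans (pair-snd< ⌜ c ⌝ ⟨ input , y ⟩)
             (<-trans (pair-snd< 0 ⟨ ⌜ c ⌝ , ⟨ input , y ⟩ ⟩) (pair-fst< halts (lc L)))))

  haltsWithin⇒halting : ∀ e s → HaltsWithin e s → Halting e
  haltsWithin⇒halting e s (S , _ , v , y , _ , m) with SemJ→E e (vc (e ∷ [])) y (sound S v m)
  ... | k , w , vc≡ , c , refl , ev with vc-inj w (e ∷ []) vc≡
  ... | refl , refl = c , refl , y , ev

module AncestorForest where

  open TruthTerms using (least; least-or; <-+1)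

  <⇒≤∸1 : ∀ {t t′} → t < t′ → t ≤ t′ ∸ 1
  <⇒≤∸1 {t} {suc t′} (s≤s h) = h

  ∸1< : ∀ {t t′} → t < t′ → t′ ∸ 1 < t′
  ∸1< {t} {suc t′} _ = ≤-refl

  module Construction (HaltsBy : ℕ → ℕ → Set) (HaltsBy? : ∀ e t → Dec (HaltsBy e t))
           (HaltsBy-mono : ∀ {e t t'} → t ≤ t' → HaltsBy e t → HaltsBy e t')
           (HaltsBy⇒< : ∀ {e t} → HaltsBy e t → e < t)
           (κ : ℕ → ℕ) where

    HaltsAt : ℕ → ℕ → Set
    HaltsAt e t = HaltsBy e t × ¬ HaltsBy e (t ∸ 1)

    HaltsAt? : ∀ e t → Dec (HaltsAt e t)
    HaltsAt? e t = HaltsBy? e t ×-dec ¬? (HaltsBy? e (t ∸ 1))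

    HaltsAt-unique : ∀ {e t t′} → HaltsAt e t → HaltsAt e t′ → t ≡ t′
    HaltsAt-unique {e} {t} {t′} (h , ¬h) (h′ , ¬h′) with <-cmp t t′
    ... | tri≈ _ eq _ = eq
    ... | tri< t<t′ _ _ = ⊥-elim (¬h′ (HaltsBy-mono (<⇒≤∸1 t<t′) h))
    ... | tri> _ _ t′<t = ⊥-elim (¬h (HaltsBy-mono (<⇒≤∸1 t′<t) h′))

    Alive : ℕ → ℕ → Set
    Alive s t = ∀ e → e < κ s + 1 → HaltsBy e t → HaltsBy e s

    HaltsBetween : ℕ → ℕ → ℕ → Set
    HaltsBetween s t e = HaltsBy e t × ¬ HaltsBy e s

    HaltsBetween? : ∀ s t e → Dec (HaltsBetween s t e)
    HaltsBetween? s t e = HaltsBy? e t ×-dec ¬? (HaltsBy? e s)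

    ¬Alive⇒witness : ∀ {s t} → ¬ Alive s t → Σ ℕ λ e → e < κ s + 1 × HaltsBetween s t e
    ¬Alive⇒witness {s} {t} ¬alive with least-or (κ s + 1) (HaltsBetween s t) (HaltsBetween? s t)
    ... | inj₁ (e , e≤κ , h , _) = e , e≤κ , h
    ... | inj₂ none = ⊥-elim (¬alive λ e e≤κ h → decidable-stable (HaltsBy? e s) λ ¬h → none e e≤κ (h , ¬h))

    Alive? : ∀ s t → Dec (Alive s t)
    Alive? s t with least-or (κ s + 1) (HaltsBetween s t) (HaltsBetween? s t)
    ... | inj₁ (e , e≤κ , (h , ¬h) , _) = no λ alive → ¬h (alive e e≤κ h)
    ... | inj₂ none = yes λ e e≤κ h → decidable-stable (HaltsBy? e s) λ ¬h → none e e≤κ (h , ¬h)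

    Alive-refl : ∀ s → Alive s s
    Alive-refl s e _ h = h

    Alive-≤ : ∀ {s t t′} → t′ ≤ t → Alive s t → Alive s t′
    Alive-≤ t′≤t alive e e≤κ h = alive e e≤κ (HaltsBy-mono t′≤t h)

    Dead : ℕ → ℕ → Set
    Dead s t = s < t × ¬ Alive s t

    Dead? : ∀ s t → Dec (Dead s t)
    Dead? s t = s <? t ×-dec ¬? (Alive? s t)

    Dies : ℕ → ℕ → Set
    Dies s r = s < r × Alive s (r ∸ 1) × ¬ Alive s r

    least-dead⇒Dies : ∀ {s r} → Dead s r → (∀ i → i < r → ¬ Dead s i) → Dies s r
    least-dead⇒Dies {s} {r} (s<r , ¬alive) earlier = s<r , alive-before , ¬alive
      where
      alive-before : Alive s (r ∸ 1)
      alive-before with s <? r ∸ 1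
      ... | yes s<r∸1 = decidable-stable (Alive? s (r ∸ 1)) λ ¬a → earlier (r ∸ 1) (∸1< s<r) (s<r∸1 , ¬a)
      ... | no s≮r∸1 = subst (Alive s) (≤-antisym (<⇒≤∸1 s<r) (≮⇒≥ s≮r∸1)) (Alive-refl s)

    Dies⇒alive-before : ∀ {s r i} → Dies s r → i < r → ¬ Dead s i
    Dies⇒alive-before (_ , alive , _) i<r (_ , ¬alive) = ¬alive (Alive-≤ (<⇒≤∸1 i<r) alive)

    first-death : ∀ {s t} → Dead s t → Σ ℕ λ r → r ≤ t × Dies s r
    first-death {s} {t} dead with least (suc t) (Dead s) (Dead? s) (t , ≤-refl , dead)
    ... | r , r<1+t , dead-r , earlier = r , ≤-pred r<1+t , least-dead⇒Dies dead-r earlier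

    module WithKiller (κ-spec : ∀ t → HaltsAt (κ t) t ⊎ (κ t ≡ t × (∀ e → ¬ HaltsAt e t)))
             (κ-min : ∀ t e → HaltsAt e t → κ t ≤ e) where

      κ≤ : ∀ t → κ t ≤ t
      κ≤ t with κ-spec t
      ... | inj₁ (h , _) = <⇒≤ (HaltsBy⇒< h)
      ... | inj₂ (eq , _) = ≤-reflexive eq

      Alive⇒κ< : ∀ {s t} → s < t → Alive s t → κ s < κ t
      Alive⇒κ< {s} {t} s<t alive with κ-spec t
      ... | inj₂ (eq , _) = <-≤-trans (s≤s (κ≤ s)) (subst (suc s ≤_) (sym eq) s<t)
      ... | inj₁ (h , ¬h) with κ s <? κ t
      ...   | yes κs<κt = κs<κt
      ...   | no κs≮κt = ⊥-elim (¬h (HaltsBy-mono (<⇒≤∸1 s<t) (alive (κ t) (<-+1 (≮⇒≥ κs≮κt)) h)))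

      Alive-trans : ∀ {s t u} → s < t → Alive s t → Alive t u → Alive s u
      Alive-trans s<t alive alive′ e e≤κ h =
        alive e e≤κ (alive′ e (<-≤-trans e≤κ (+-monoˡ-≤ 1 (<⇒≤ (Alive⇒κ< s<t alive)))) h)

      Dies⇒κ-halts : ∀ {s r} → Dies s r → HaltsAt (κ r) r × κ r ≤ κ s
      Dies⇒κ-halts {s} {r} (s<r , alive , ¬alive) with ¬Alive⇒witness ¬alive
      ... | e , e≤κ , h , ¬h = κ-halts , ≤-trans (κ-min r e e-halts) (≤-pred (subst (e <_) (+-comm (κ s) 1) e≤κ))
        where
        e-halts : HaltsAt e r
        e-halts = h , λ h′ → ¬h (alive e e≤κ h′)
        κ-halts : HaltsAt (κ r) r
        κ-halts with κ-spec r
        ... | inj₁ x = x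
        ... | inj₂ (_ , none) = ⊥-elim (none e e-halts)

      Dies-unique : ∀ {s r r′} → Dies s r → Dies s r′ → r ≡ r′
      Dies-unique {s} {r} {r′} (_ , alive , ¬alive) (_ , alive′ , ¬alive′) with <-cmp r r′
      ... | tri≈ _ eq _ = eq
      ... | tri< r<r′ _ _ = ⊥-elim (¬alive (Alive-≤ (<⇒≤∸1 r<r′) alive′))
      ... | tri> _ _ r′<r = ⊥-elim (¬alive′ (Alive-≤ (<⇒≤∸1 r′<r) alive))

      Dies⇒dead-before : ∀ {z r x} → Dies z r → z < x → x < r → ¬ Alive x r
      Dies⇒dead-before {z} {r} {x} (z<r , alive , ¬alive) z<x x<r alive-x with ¬Alive⇒witness ¬alive
      ... | e , e≤κ , h , ¬h = ¬h (alive e e≤κ (HaltsBy-mono (<⇒≤∸1 x<r) h-x))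
        where
        h-x : HaltsBy e x
        h-x = alive-x e (<-≤-trans e≤κ (+-monoˡ-≤ 1 (<⇒≤ (Alive⇒κ< z<x (Alive-≤ (<⇒≤∸1 x<r) alive))))) h

      data Chain : ℕ → ℕ → Set where
        done : ∀ {s r} → Dies s r → Chain s r
        next : ∀ {s r t} → Dies s r → Chain r t → Chain s t

      Chain-< : ∀ {s t} → Chain s t → s < t
      Chain-< (done (s<r , _)) = s<r
      Chain-< (next (s<r , _) c) = <-trans s<r (Chain-< c)

      Chain-first : ∀ {s t} → Chain s t → Σ ℕ λ r → Dies s r × r ≤ t
      Chain-first (done d) = _ , d , ≤-refl
      Chain-first (next d c) = _ , d , <⇒≤ (Chain-< c)

      Chain⇒¬Alive : ∀ {z y} → Chain z y → ¬ Alive z y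
      Chain⇒¬Alive c a with Chain-first c
      ... | r , (_ , _ , nar) , r≤y = nar (Alive-≤ r≤y a)

      Chain-trans : ∀ {a b c} → Chain a b → Chain b c → Chain a c
      Chain-trans (done d) c2 = next d c2
      Chain-trans (next d c1) c2 = next d (Chain-trans c1 c2)

      Chain-snoc : ∀ {a b c} → Chain a b → Dies b c → Chain a c
      Chain-snoc c1 d = Chain-trans c1 (done d)

      Chain-linear : ∀ {z a b} → Chain z a → Chain z b → a ≡ b ⊎ (Chain a b ⊎ Chain b a)
      Chain-linear (done d1) (done d2) = inj₁ (Dies-unique d1 d2)
      Chain-linear (done d1) (next d2 c2) rewrite Dies-unique d1 d2 = inj₂ (inj₁ c2)
      Chain-linear (next d1 c1) (done d2) rewrite Dies-unique d1 d2 = inj₂ (inj₂ c1)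
      Chain-linear (next d1 c1) (next d2 c2) rewrite Dies-unique d1 d2 = Chain-linear c1 c2

      Chain-κ : ∀ {v w} → Chain v w → κ w ≤ κ v
      Chain-κ (done d) = proj₂ (Dies⇒κ-halts d)
      Chain-κ (next d c) = ≤-trans (Chain-κ c) (proj₂ (Dies⇒κ-halts d))

      Chain-halts : ∀ {v w} → Chain v w → HaltsAt (κ w) w
      Chain-halts (done d) = proj₁ (Dies⇒κ-halts d)
      Chain-halts (next d c) = Chain-halts c

      Alive⇒<death : ∀ {y z r} → Alive y z → Dies y r → z < r
      Alive⇒<death {z = z} {r} alive (_ , _ , ¬alive) with z <? r
      ... | yes z<r = z<r
      ... | no z≮r = ⊥-elim (¬alive (Alive-≤ (≮⇒≥ z≮r) alive))

      -- A vertex born during the life of y dies at the latest when y does, and the vertex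
      -- born at its death is again born during the life of y: following deaths reaches r.
      Alive⇒Chain : ∀ {y r} → Dies y r → ∀ {z} → Alive y z → y < z → Chain z r
      Alive⇒Chain {y} {r} dies {z} = <-rec P step (r ∸ z) refl
        where
        P : ℕ → Set
        P n = ∀ {z} → r ∸ z ≡ n → Alive y z → y < z → Chain z r
        step : ∀ n → (∀ {m} → m < n → P m) → P n
        step _ ih {z} refl alive y<z
          with first-death (Alive⇒<death alive dies , Dies⇒dead-before dies y<z (Alive⇒<death alive dies))
        ... | r′ , r′≤r , dies-z with m≤n⇒m<n∨m≡n r′≤r
        ...   | inj₂ refl = done dies-z
        ...   | inj₁ r′<r = next dies-z (ih (∸-monoʳ-< (proj₁ dies-z) r′≤r) refl
                                           (Alive-≤ (<⇒≤∸1 r′<r) (proj₁ (proj₂ dies))) (<-trans y<z (proj₁ dies-z)))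

      Ancestor : ℕ → ℕ → Set
      Ancestor x y = (x < y × Alive x y) ⊎ Chain y x

      Ancestor-irrefl : ∀ {x} → ¬ Ancestor x x
      Ancestor-irrefl (inj₁ (p , _)) = <-irrefl refl p
      Ancestor-irrefl (inj₂ c) = <-irrefl refl (Chain-< c)

      Chain-prefix : ∀ {z y x} → Chain z y → z < x → x < y → Alive x y → Chain z x
      Chain-prefix (done d) z<x x<y axy = ⊥-elim (Dies⇒dead-before d z<x x<y axy)
      Chain-prefix {z} {y} {x} (next {r = r} d c) z<x x<y axy with <-cmp x r
      ... | tri< x<r _ _ = ⊥-elim (Dies⇒dead-before d z<x x<r (Alive-≤ (<⇒≤ (Chain-< c)) axy))
      ... | tri≈ _ refl _ = done d
      ... | tri> _ _ r<x = next d (Chain-prefix c r<x x<y axy)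

      Ancestor-trans : ∀ {x y z} → Ancestor x y → Ancestor y z → Ancestor x z
      Ancestor-trans (inj₁ (x<y , axy)) (inj₁ (y<z , ayz)) = inj₁ (<-trans x<y y<z , Alive-trans x<y axy ayz)
      Ancestor-trans {x} {y} {z} (inj₁ (x<y , axy)) (inj₂ czy) with <-cmp x z
      ... | tri< x<z _ _ = inj₁ (x<z , Alive-≤ (<⇒≤ (Chain-< czy)) axy)
      ... | tri≈ _ refl _ = ⊥-elim (Chain⇒¬Alive czy axy)
      ... | tri> _ _ z<x = inj₂ (Chain-prefix czy z<x x<y axy)
      Ancestor-trans (inj₂ (done d)) (inj₁ (y<z , ayz)) = inj₂ (Alive⇒Chain d ayz y<z)
      Ancestor-trans (inj₂ (next d c)) (inj₁ (y<z , ayz)) = inj₂ (Chain-trans (Alive⇒Chain d ayz y<z) c)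
      Ancestor-trans (inj₂ cyx) (inj₂ czy) = inj₂ (Chain-trans czy cyx)

      Alive-Chain-comparable : ∀ {x y z} → x < z → Alive x z → Chain z y → Ancestor x y ⊎ Ancestor y x
      Alive-Chain-comparable {x} {y} {z} x<z axz czy with Alive? x y
      ... | yes axy = inj₁ (inj₁ (<-trans x<z (Chain-< czy) , axy))
      ... | no naxy with first-death (<-trans x<z (Chain-< czy) , naxy)
      ...   | r , r≤y , d with Chain-linear (Alive⇒Chain d axz x<z) czy
      ...     | inj₁ refl = inj₂ (inj₂ (done d))
      ...     | inj₂ (inj₁ cry) = inj₂ (inj₂ (next d cry))
      ...     | inj₂ (inj₂ cyr) = ⊥-elim (<-irrefl refl (<-≤-trans (Chain-< cyr) r≤y))

      ancestors-comparable : ∀ {x y z} → x ≢ y → Ancestor x z → Ancestor y z → Ancestor x y ⊎ Ancestor y x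
      ancestors-comparable {x} {y} ne (inj₁ (x<z , axz)) (inj₁ (y<z , ayz)) with <-cmp x y
      ... | tri< x<y _ _ = inj₁ (inj₁ (x<y , Alive-≤ (<⇒≤ y<z) axz))
      ... | tri≈ _ eq _ = ⊥-elim (ne eq)
      ... | tri> _ _ y<x = inj₂ (inj₁ (y<x , Alive-≤ (<⇒≤ x<z) ayz))
      ancestors-comparable ne (inj₁ (x<z , axz)) (inj₂ czy) = Alive-Chain-comparable x<z axz czy
      ancestors-comparable ne (inj₂ czx) (inj₁ (y<z , ayz)) with Alive-Chain-comparable y<z ayz czx
      ... | inj₁ p = inj₂ p
      ... | inj₂ p = inj₁ p
      ancestors-comparable ne (inj₂ czx) (inj₂ czy) with Chain-linear czx czy
      ... | inj₁ eq = ⊥-elim (ne eq)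
      ... | inj₂ (inj₁ cxy) = inj₂ (inj₂ cxy)
      ... | inj₂ (inj₂ cyx) = inj₁ (inj₂ cyx)

      Adj : ℕ → ℕ → Set
      Adj x y = Ancestor x y ⊎ Ancestor y x

      middle-ancestor : ∀ {a b c} → a ≢ c → Adj a b → Adj b c → ¬ Adj a c → Ancestor b a × Ancestor b c
      middle-ancestor ne (inj₁ hab) (inj₁ hbc) nac = ⊥-elim (nac (inj₁ (Ancestor-trans hab hbc)))
      middle-ancestor ne (inj₁ hab) (inj₂ hcb) nac = ⊥-elim (nac (ancestors-comparable ne hab hcb))
      middle-ancestor ne (inj₂ hba) (inj₁ hbc) nac = hba , hbc
      middle-ancestor ne (inj₂ hba) (inj₂ hcb) nac = ⊥-elim (nac (inj₂ (Ancestor-trans hcb hba)))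

      no-induced-P4 : ∀ {a b c d} → a ≢ c → b ≢ d → Adj a b → Adj b c → Adj c d → ¬ Adj a c → ¬ Adj b d → ⊥
      no-induced-P4 ac bd hab hbc hcd nac nbd =
        Ancestor-irrefl (Ancestor-trans (proj₂ (middle-ancestor ac hab hbc nac)) (proj₁ (middle-ancestor bd hbc hcd nbd)))

      neighbours-of-dying : ∀ {v r w} → Dies v r → Adj v w → w < r ⊎ Chain v w
      neighbours-of-dying {v} {r} {w} d (inj₁ (inj₁ (v<w , avw))) with w <? r
      ... | yes p = inj₁ p
      ... | no p = ⊥-elim (proj₂ (proj₂ d) (Alive-≤ (≮⇒≥ p) avw))
      neighbours-of-dying d (inj₁ (inj₂ cwv)) = inj₁ (<-trans (Chain-< cwv) (proj₁ d))
      neighbours-of-dying d (inj₂ (inj₁ (w<v , _))) = inj₁ (<-trans w<v (proj₁ d))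
      neighbours-of-dying d (inj₂ (inj₂ cvw)) = inj₂ cvw

      -- A dying vertex has finitely many neighbours: those born before its death, and those
      -- on its chain of deaths, which are killed by pairwise distinct programs e ≤ κ v.
      neighbour-code : ℕ → ℕ → ℕ
      neighbour-code r w with w <? r
      ... | yes _ = w
      ... | no _ = r + κ w

      neighbour-code< : ∀ {v r w} → Dies v r → Adj v w → neighbour-code r w < r + κ v + 1
      neighbour-code< {v} {r} {w} dies adj with w <? r
      ... | yes w<r = ≤-trans w<r (≤-trans (m≤m+n r (κ v)) (m≤m+n (r + κ v) 1))
      ... | no w≮r with neighbours-of-dying dies adj
      ...   | inj₁ w<r = ⊥-elim (w≮r w<r)
      ...   | inj₂ c = <-+1 (+-monoʳ-≤ r (Chain-κ c))

      neighbour-code-injective : ∀ {v r w w′} → Dies v r → Adj v w → Adj v w′ →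
                                 neighbour-code r w ≡ neighbour-code r w′ → w ≡ w′
      neighbour-code-injective {v} {r} {w} {w′} dies adj adj′ e with w <? r | w′ <? r
      ... | yes _ | yes _ = e
      ... | yes w<r | no _ = ⊥-elim (<-irrefl e (<-≤-trans w<r (m≤m+n r (κ w′))))
      ... | no _ | yes w′<r = ⊥-elim (<-irrefl (sym e) (<-≤-trans w′<r (m≤m+n r (κ w))))
      ... | no w≮r | no w′≮r with neighbours-of-dying dies adj | neighbours-of-dying dies adj′
      ...   | inj₁ w<r | _ = ⊥-elim (w≮r w<r)
      ...   | _ | inj₁ w′<r = ⊥-elim (w′≮r w′<r)
      ...   | inj₂ c | inj₂ c′ =
        HaltsAt-unique (Chain-halts c) (subst (λ z → HaltsAt z w′) (sym (+-cancelˡ-≡ r (κ w) (κ w′) e)) (Chain-halts c′))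

      -- Stages with small κ are few: a stage at which a program halts is labelled by the least
      -- such program, any other stage v (where κ v = v) by e + v.
      label : ℕ → ℕ → ℕ
      label e v with HaltsAt? (κ v) v
      ... | yes _ = κ v
      ... | no _ = e + κ v

      label< : ∀ e v → κ v < e → label e v < 2 * e
      label< e v κv<e with HaltsAt? (κ v) v
      ... | yes _ = ≤-trans κv<e (m≤m+n e (e + 0))
      ... | no _ = +-monoʳ-< e (subst (κ v <_) (sym (+-identityʳ e)) κv<e)

      ¬HaltsAt⇒κ≡ : ∀ v → ¬ HaltsAt (κ v) v → κ v ≡ v
      ¬HaltsAt⇒κ≡ v ¬h with κ-spec v
      ... | inj₁ h = ⊥-elim (¬h h)
      ... | inj₂ (eq , _) = eq

      label-injective : ∀ e v v′ → κ v < e → κ v′ < e → label e v ≡ label e v′ → v ≡ v′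
      label-injective e v v′ κv<e κv′<e eq with HaltsAt? (κ v) v | HaltsAt? (κ v′) v′
      ... | yes h | yes h′ = HaltsAt-unique h (subst (λ z → HaltsAt z v′) (sym eq) h′)
      ... | yes _ | no _ = ⊥-elim (<-irrefl eq (<-≤-trans κv<e (m≤m+n e (κ v′))))
      ... | no _ | yes _ = ⊥-elim (<-irrefl (sym eq) (<-≤-trans κv′<e (m≤m+n e (κ v))))
      ... | no ¬h | no ¬h′ = trans (sym (¬HaltsAt⇒κ≡ v ¬h)) (trans (+-cancelˡ-≡ e (κ v) (κ v′) eq) (¬HaltsAt⇒κ≡ v′ ¬h′))

module HaltingForest where

  open Terms
  open TruthTerms
  open Pairing
  open SequenceCodes
  open BoundedFormulas
  open Derivations
  open HaltingNormalForm
  open AncestorForest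

  HaltsBy : ℕ → ℕ → Set
  HaltsBy e t = e < t × HaltsWithin e t

  opaque
    HaltsByF : Fm 2
    HaltsByF = andF (ltF v0 v1) HaltsWithinF

    HaltsByF→ : ∀ e t → holds HaltsByF (e ∷ t ∷ []) → HaltsBy e t
    HaltsByF→ e t (p , h) = p , HaltsWithinF→ e t h

    HaltsByF← : ∀ e t → HaltsBy e t → holds HaltsByF (e ∷ t ∷ [])
    HaltsByF← e t (p , h) = p , HaltsWithinF← e t h

  HaltsBy? : ∀ e t → Dec (HaltsBy e t)
  HaltsBy? e t with holds? HaltsByF (e ∷ t ∷ [])
  ... | yes p = yes (HaltsByF→ e t p)
  ... | no p = no λ h → p (HaltsByF← e t h)

  HaltsBy-mono : ∀ {e t t'} → t ≤ t' → HaltsBy e t → HaltsBy e t'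
  HaltsBy-mono {e} {t} {t'} le (p , h) = <-≤-trans p le , HaltsWithin-mono e le h

  HaltsBy⇒< : ∀ {e t} → HaltsBy e t → e < t
  HaltsBy⇒< = proj₁

  halting⇔ : ∀ e → (Halting e → Σ ℕ (HaltsBy e)) × (Σ ℕ (HaltsBy e) → Halting e)
  halting⇔ e = halts , λ (t , _ , h) → haltsWithin⇒halting e t h
    where
    halts : Halting e → Σ ℕ (HaltsBy e)
    halts H = let (s , h) = halting⇒haltsWithin e H in
      s + suc e , ≤-trans (s≤s (m≤n+m e s)) (≤-reflexive (sym (+-suc s e))) , HaltsWithin-mono e (m≤m+n s (suc e)) h

  HaltsAtF : Fm 2
  HaltsAtF = andF (subF HaltsByF (v0 ∷ v1 ∷ [])) (notF (subF HaltsByF (v0 ∷ (v1 ⊝ lit 1) ∷ [])))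

  opaque
    κT : Tm 1
    κT = muT v0 (toT HaltsAtF)

  κ : ℕ → ℕ
  κ t = ev κT (t ∷ [])

  opaque
    unfolding κT
    κ-eq : ∀ t → κ t ≡ muN t (λ e → ev (toT HaltsAtF) (e ∷ t ∷ []))
    κ-eq t = ev-muT v0 (toT HaltsAtF) (t ∷ [])

  open Construction HaltsBy HaltsBy? HaltsBy-mono HaltsBy⇒< κ public

  HaltsAtF→ : ∀ e t → holds HaltsAtF (e ∷ t ∷ []) → HaltsAt e t
  HaltsAtF→ e t (p , q) = HaltsByF→ e t p , λ h → q (HaltsByF← e (t ∸ 1) h)

  HaltsAtF← : ∀ e t → HaltsAt e t → holds HaltsAtF (e ∷ t ∷ [])
  HaltsAtF← e t (p , q) = HaltsByF← e t p , λ h → q (HaltsByF→ e (t ∸ 1) h)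

  κ-char : ∀ t → (Σ ℕ λ w → w < t × HaltsAt w t × (∀ i → i < w → ¬ HaltsAt i t) × κ t ≡ w) ⊎ ((∀ e → ¬ HaltsAt e t) × κ t ≡ t)
  κ-char t with least-or t (λ e → HaltsAt e t) (λ e → HaltsAt? e t)
  ... | inj₁ (w , w<t , hw , mn) =
    inj₁ (w , w<t , hw , mn , trans (κ-eq t)
       (muN-above t w _ (<⇒≤ w<t) (refl⇐ HaltsAtF (w ∷ t ∷ []) (HaltsAtF← w t hw))
          λ i i<w tr → mn i i<w (HaltsAtF→ i t (refl⇒ HaltsAtF (i ∷ t ∷ []) tr))))
  ... | inj₂ none =
    inj₂ ((λ e h → none e (HaltsBy⇒< (proj₁ h)) h) , trans (κ-eq t)
       (muN-below t t _ ≤-refl λ i i<t tr → none i i<t (HaltsAtF→ i t (refl⇒ HaltsAtF (i ∷ t ∷ []) tr))))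

  κ-spec : ∀ t → HaltsAt (κ t) t ⊎ (κ t ≡ t × (∀ e → ¬ HaltsAt e t))
  κ-spec t with κ-char t
  ... | inj₁ (w , _ , hw , _ , eq) = inj₁ (subst (λ z → HaltsAt z t) (sym eq) hw)
  ... | inj₂ (none , eq) = inj₂ (eq , none)

  κ-min : ∀ t e → HaltsAt e t → κ t ≤ e
  κ-min t e he with κ-char t
  ... | inj₁ (w , _ , hw , mn , eq) with w ≤? e
  ...   | yes p = subst (_≤ e) (sym eq) p
  ...   | no p = ⊥-elim (mn e (≰⇒> p) he)
  κ-min t e he | inj₂ (none , _) = ⊥-elim (none e he)

  open WithKiller κ-spec κ-min public

  opaque
    AliveF : Fm 2
    AliveF = allF (sub κT (v0 ∷ []) ⊕ lit 1) (impF (subF HaltsByF (v0 ∷ v2 ∷ [])) (subF HaltsByF (v0 ∷ v1 ∷ [])))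

    AliveF→ : ∀ s t → holds AliveF (s ∷ t ∷ []) → Alive s t
    AliveF→ s t h e b hg = HaltsByF→ e s (h e b (HaltsByF← e t hg))

    AliveF← : ∀ s t → Alive s t → holds AliveF (s ∷ t ∷ [])
    AliveF← s t a e b hg = HaltsByF← e s (a e b (HaltsByF→ e t hg))

  DeadF : Fm 3
  DeadF = andF (ltF v1 v0) (notF (subF AliveF (v1 ∷ v0 ∷ [])))

  opaque
    nextDeathT : Tm 2
    nextDeathT = muT (v1 ⊕ lit 1) (toT DeadF)

  nextDeath : ℕ → ℕ → ℕ
  nextDeath x t = ev nextDeathT (x ∷ t ∷ [])

  opaque
    unfolding nextDeathT
    nextDeath-eq : ∀ x t → nextDeath x t ≡ muN (t + 1) (λ r → ev (toT DeadF) (r ∷ x ∷ t ∷ []))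
    nextDeath-eq x t = ev-muT (v1 ⊕ lit 1) (toT DeadF) (x ∷ t ∷ [])

  DeadF→ : ∀ r x t → Tr (ev (toT DeadF) (r ∷ x ∷ t ∷ [])) → x < r × ¬ Alive x r
  DeadF→ r x t tr = let (p , q) = refl⇒ DeadF (r ∷ x ∷ t ∷ []) tr in p , λ a → q (AliveF← x r a)

  DeadF← : ∀ r x t → x < r × ¬ Alive x r → Tr (ev (toT DeadF) (r ∷ x ∷ t ∷ []))
  DeadF← r x t (p , q) = refl⇐ DeadF (r ∷ x ∷ t ∷ []) (p , λ h → q (AliveF→ x r h))

  nextDeath-cases : ∀ x t → (nextDeath x t ≤ t × Dies x (nextDeath x t)) ⊎ nextDeath x t ≡ t + 1
  nextDeath-cases x t with least-or (t + 1) (Dead x) (Dead? x)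
  ... | inj₁ (r , r<t1 , (x<r , nar) , mn) =
    inj₁ (subst (_≤ t) (sym eq) (≤-pred (subst (r <_) (+-comm t 1) r<t1)) ,
          subst (Dies x) (sym eq) (least-dead⇒Dies (x<r , nar) mn))
    where
    eq : nextDeath x t ≡ r
    eq = trans (nextDeath-eq x t) (muN-above (t + 1) r _ (<⇒≤ r<t1) (DeadF← r x t (x<r , nar))
           λ i i<r tr → mn i i<r (DeadF→ i x t tr))
  ... | inj₂ none = inj₂ (trans (nextDeath-eq x t) (muN-below (t + 1) (t + 1) _ ≤-refl λ i i<t1 tr → none i i<t1 (DeadF→ i x t tr)))

  nextDeath-Dies : ∀ {x r t} → Dies x r → r ≤ t → nextDeath x t ≡ r
  nextDeath-Dies {x} {r} {t} d r≤t = trans (nextDeath-eq x t) (muN-above (t + 1) r _ (≤-trans r≤t (<⇒≤ (<-+1 ≤-refl)))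
    (DeadF← r x t (proj₁ d , proj₂ (proj₂ d))) λ i i<r tr → Dies⇒alive-before d i<r (DeadF→ i x t tr))

  opaque
    iterateT : Tm 3
    iterateT = rc v1 (sub nextDeathT (v1 ∷ v4 ∷ [])) v0

  iterate : ℕ → ℕ → ℕ → ℕ
  iterate j s t = ev iterateT (j ∷ s ∷ t ∷ [])

  opaque
    unfolding iterateT
    iterate-zero : ∀ s t → iterate 0 s t ≡ s
    iterate-zero s t = refl
    iterate-suc : ∀ j s t → iterate (suc j) s t ≡ nextDeath (iterate j s t) t
    iterate-suc j s t = refl

  iterate-tail : ∀ j s t → iterate (suc j) s t ≡ iterate j (nextDeath s t) t
  iterate-tail zero s t = trans (iterate-suc 0 s t) (trans (cong (λ z → nextDeath z t) (iterate-zero s t)) (sym (iterate-zero (nextDeath s t) t)))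
  iterate-tail (suc j) s t = trans (iterate-suc (suc j) s t) (trans (cong (λ z → nextDeath z t) (iterate-tail j s t)) (sym (iterate-suc j (nextDeath s t) t)))

  nextDeath-overflow : ∀ x t → t ≤ x → nextDeath x t ≡ t + 1
  nextDeath-overflow x t t≤x with nextDeath-cases x t
  ... | inj₂ eq = eq
  ... | inj₁ (le , d) = ⊥-elim (<-irrefl refl (<-≤-trans (<-≤-trans (proj₁ d) le) t≤x))

  ChainF : Fm 2
  ChainF = andF (ltF v0 v1) (exF (v1 ⊕ lit 1) (eqF (sub iterateT (v0 ∷ v1 ∷ v2 ∷ [])) v2))

  Chain⇒iterate : ∀ {s t} → Chain s t → Σ ℕ λ j → j ≤ t ∸ s × 1 ≤ j × iterate j s t ≡ t
  Chain⇒iterate {s} {t} (done d) = 1 , m<n⇒0<n∸m (proj₁ d) , ≤-refl ,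
    trans (iterate-suc 0 s t) (trans (cong (λ z → nextDeath z t) (iterate-zero s t)) (nextDeath-Dies d ≤-refl))
  Chain⇒iterate {s} {t} (next {r = r} d c) with Chain⇒iterate c
  ... | j , j≤ , 1≤j , e = suc j , le , s≤s z≤n ,
    trans (iterate-tail j s t) (trans (cong (λ z → iterate j z t) (nextDeath-Dies d (<⇒≤ (Chain-< c)))) e)
    where
    le : suc j ≤ t ∸ s
    le = ≤-trans (s≤s j≤) (≤-trans (≤-reflexive (sym (+-∸-assoc 1 (<⇒≤ (Chain-< c)))))
           (∸-monoʳ-≤ (1 + t) (proj₁ d)))

  Chain⇒ChainF : ∀ {s t} → Chain s t → holds ChainF (s ∷ t ∷ [])
  Chain⇒ChainF {s} {t} c with Chain⇒iterate c
  ... | j , j≤ , _ , e = Chain-< c , j , ≤-trans (s≤s (≤-trans j≤ (m∸n≤m t s))) (≤-reflexive (+-comm 1 t)) , e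

  iterate-cases : ∀ s t j → s < t → iterate j s t ≡ s ⊎ ((Chain s (iterate j s t) × iterate j s t ≤ t) ⊎ iterate j s t ≡ t + 1)
  iterate-cases s t zero s<t = inj₁ (iterate-zero s t)
  iterate-cases s t (suc j) s<t with iterate-cases s t j s<t
  ... | inj₁ eq with nextDeath-cases s t
  ...   | inj₁ (le , d) = inj₂ (inj₁ (subst (λ z → Chain s z × z ≤ t) (sym (trans (iterate-suc j s t) (cong (λ z → nextDeath z t) eq))) (done d , le)))
  ...   | inj₂ e = inj₂ (inj₂ (trans (iterate-suc j s t) (trans (cong (λ z → nextDeath z t) eq) e)))
  iterate-cases s t (suc j) s<t | inj₂ (inj₁ (c , le)) with iterate j s t <? t
  ...   | no p = inj₂ (inj₂ (trans (iterate-suc j s t) (nextDeath-overflow (iterate j s t) t (≮⇒≥ p))))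
  ...   | yes p with nextDeath-cases (iterate j s t) t
  ...     | inj₁ (le' , d) = inj₂ (inj₁ (subst (λ z → Chain s z × z ≤ t) (sym (iterate-suc j s t)) (Chain-snoc c d , le')))
  ...     | inj₂ e = inj₂ (inj₂ (trans (iterate-suc j s t) e))
  iterate-cases s t (suc j) s<t | inj₂ (inj₂ eq) =
    inj₂ (inj₂ (trans (iterate-suc j s t) (trans (cong (λ z → nextDeath z t) eq) (nextDeath-overflow (t + 1) t (<⇒≤ (<-+1 ≤-refl))))))

  ChainF⇒Chain : ∀ {s t} → holds ChainF (s ∷ t ∷ []) → Chain s t
  ChainF⇒Chain {s} {t} (s<t , j , _ , e) with iterate-cases s t j s<t
  ... | inj₁ eq = ⊥-elim (<-irrefl (trans (sym eq) e) s<t)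
  ... | inj₂ (inj₁ (c , _)) = subst (Chain s) e c
  ... | inj₂ (inj₂ eq) = ⊥-elim (<-irrefl (trans (sym e) eq) (<-+1 ≤-refl))

  AncestorF : Fm 2
  AncestorF = orF (andF (ltF v0 v1) (subF AliveF (v0 ∷ v1 ∷ []))) (subF ChainF (v1 ∷ v0 ∷ []))

  AdjF : Fm 2
  AdjF = orF AncestorF (subF AncestorF (v1 ∷ v0 ∷ []))

  AncestorF→ : ∀ x y → holds AncestorF (x ∷ y ∷ []) → Ancestor x y
  AncestorF→ x y (inj₁ (p , a)) = inj₁ (p , AliveF→ x y a)
  AncestorF→ x y (inj₂ c) = inj₂ (ChainF⇒Chain c)

  AncestorF← : ∀ x y → Ancestor x y → holds AncestorF (x ∷ y ∷ [])
  AncestorF← x y (inj₁ (p , a)) = inj₁ (p , AliveF← x y a)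
  AncestorF← x y (inj₂ c) = inj₂ (Chain⇒ChainF c)

  AdjF→ : ∀ x y → holds AdjF (x ∷ y ∷ []) → Adj x y
  AdjF→ x y (inj₁ h) = inj₁ (AncestorF→ x y h)
  AdjF→ x y (inj₂ h) = inj₂ (AncestorF→ y x h)

  AdjF← : ∀ x y → Adj x y → holds AdjF (x ∷ y ∷ [])
  AdjF← x y (inj₁ h) = inj₁ (AncestorF← x y h)
  AdjF← x y (inj₂ h) = inj₂ (AncestorF← y x h)


module Decoding where

  open Terms
  open TruthTerms
  open BoundedFormulas
  open AncestorForest
  open HaltingForest

  no-injection : ∀ B (h : ℕ → ℕ) → (∀ i → i < suc B → h i < B) →
                 (∀ i j → i < suc B → j < suc B → h i ≡ h j → i ≡ j) → ⊥
  no-injection B h h< h-inj with pigeonhole ≤-refl (λ i → fromℕ< (h< (toℕ i) (toℕ<n i)))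
  ... | i , j , i<j , e = <-irrefl (h-inj (toℕ i) (toℕ j) (toℕ<n i) (toℕ<n j) hi≡hj) i<j
    where
    hi≡hj : h (toℕ i) ≡ h (toℕ j)
    hi≡hj = trans (sym (toℕ-fromℕ< (h< (toℕ i) (toℕ<n i)))) (trans (cong toℕ e) (toℕ-fromℕ< (h< (toℕ j) (toℕ<n j))))

  module FromEmbedding (f : ℕ → ℕ) (f-injective : ∀ x y → f x ≡ f y → x ≡ y)
                       (f-adj : ∀ n m → n ≤ m → Adj (f (a n)) (f (b m))) where

    b-injective : ∀ m m′ → f (b m) ≡ f (b m′) → m ≡ m′
    b-injective m m′ e = *-cancelˡ-≡ m m′ 2 (suc-injective (f-injective (b m) (b m′) e))

    a-immortal : ∀ n t → Alive (f (a n)) t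
    a-immortal n t with Alive? (f (a n)) t
    ... | yes alive = alive
    ... | no ¬alive with f (a n) <? t
    ...   | no v≮t = ⊥-elim (¬alive (Alive-≤ (≮⇒≥ v≮t) (Alive-refl _)))
    ...   | yes v<t with first-death (v<t , ¬alive)
    ...     | r , _ , dies = ⊥-elim (no-injection (r + κ (f (a n)) + 1) code (λ i _ → neighbour-code< dies (adj i))
              λ i j _ _ e → +-cancelˡ-≡ n i j (b-injective (n + i) (n + j) (neighbour-code-injective dies (adj i) (adj j) e)))
      where
      adj : ∀ i → Adj (f (a n)) (f (b (n + i)))
      adj i = f-adj n (n + i) (m≤m+n n i)
      code : ℕ → ℕ
      code i = neighbour-code r (f (b (n + i)))

    a-with-large-κ : ∀ e → Σ ℕ λ j → j < 2 * e + 1 × e ≤ κ (f (a j))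
    a-with-large-κ e with least-or (2 * e + 1) (λ j → e ≤ κ (f (a j))) (λ j → e ≤? κ (f (a j)))
    ... | inj₁ (j , j< , e≤κ , _) = j , j< , e≤κ
    ... | inj₂ none = ⊥-elim (no-injection (2 * e) (λ i → label e (f (a i))) (λ i i< → label< e _ (small i i<))
                        λ i j i< j< eq → *-cancelˡ-≡ i j 2 (f-injective (a i) (a j) (label-injective e _ _ (small i i<) (small j j<) eq)))
      where
      small : ∀ i → i < suc (2 * e) → κ (f (a i)) < e
      small i i< = ≰⇒> (none i (subst (i <_) (+-comm 1 (2 * e)) i<))

    -- The maximum of f (a j) for j < n, written with + and ∸ to keep its code short.
    max-a : ℕ → ℕ
    max-a zero = 0
    max-a (suc n) = max-a n + (f (a n) ∸ max-a n)

    max-a-≥ : ∀ n j → j < n → f (a j) ≤ max-a n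
    max-a-≥ (suc n) j j<1+n with j ≟ n
    ... | yes refl = m≤n+m∸n (f (a n)) (max-a n)
    ... | no j≢n = ≤-trans (max-a-≥ n j (≤∧≢⇒< (≤-pred j<1+n) j≢n)) (m≤m+n (max-a n) _)

    bound : ℕ → ℕ
    bound e = max-a (2 * e + 1)

    -- Some f (a j) with j ≤ 2e never dies and has κ ≥ e, so if e halts at all it halts by that stage.
    halting⇔HaltsBy-bound : ∀ e → (Halting e → HaltsBy e (bound e)) × (HaltsBy e (bound e) → Halting e)
    halting⇔HaltsBy-bound e = halts , λ h → proj₂ (halting⇔ e) (bound e , h)
      where
      halts : Halting e → HaltsBy e (bound e)
      halts H with a-with-large-κ e | proj₁ (halting⇔ e) H
      ... | j , j< , e≤κ | t , h =
        HaltsBy-mono (max-a-≥ (2 * e + 1) j j<)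
          (a-immortal j (t + f (a j)) e (<-+1 e≤κ) (HaltsBy-mono (m≤m+n t (f (a j))) h))

    cf-bound : ComputableIn f 1 (λ xs → bound (head xs))
    cf-bound = cf-ext f (cf-comp f (cf-prec f (cf-const f 0)
                    (cf2 f _+_ (cf-add f) (cf-proj f (suc zero))
                       (cf2 f _∸_ (cf-mon f) (cf-comp f (cf-orc f) (cf2 f _*_ (cf-mul f) (cf-const f 2) (cf-proj f zero) ∷ []))
                                             (cf-proj f (suc zero)))))
                   (cf2 f _+_ (cf-add f) (cf2 f _*_ (cf-mul f) (cf-const f 2) (cf-proj f zero)) (cf-const f 1) ∷ []))
            λ { (e ∷ []) → recV-max-a (2 * e + 1) }
      where
      recV-max-a : ∀ n → primrec f (λ _ → 0) (λ v → lookup v (suc zero) + (f (2 * lookup v zero) ∸ lookup v (suc zero))) (n ∷ [])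
                         ≡ max-a n
      recV-max-a zero = refl
      recV-max-a (suc n) = cong (λ z → z + (f (a n) ∸ z)) (recV-max-a n)

    halting-computable : ComputableFrom f Halting
    halting-computable with decide f HaltsByF | cf-bound
    ... | c-halts , c-halts-spec | c-bound , c-bound-spec =
      comp c-halts (proj zero ∷ c-bound ∷ []) , λ e → decided e (c-halts-spec (e ∷ bound e ∷ []))
      where
      args : ∀ e → EvalVec f (proj zero ∷ c-bound ∷ []) (e ∷ []) (e ∷ bound e ∷ [])
      args e = ev-∷ e-proj (ev-∷ (c-bound-spec (e ∷ [])) ev-[])
      decided : ∀ e →
        (holds HaltsByF (e ∷ bound e ∷ []) × Eval f c-halts (e ∷ bound e ∷ []) 1) ⊎
        (¬ holds HaltsByF (e ∷ bound e ∷ []) × Eval f c-halts (e ∷ bound e ∷ []) 0) →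
        (Halting e × Eval f (comp c-halts (proj zero ∷ c-bound ∷ [])) (e ∷ []) 1) ⊎
        (¬ Halting e × Eval f (comp c-halts (proj zero ∷ c-bound ∷ [])) (e ∷ []) 0)
      decided e (inj₁ (h , ev)) = inj₁ (proj₂ (halting⇔HaltsBy-bound e) (HaltsByF→ e (bound e) h) , e-comp (args e) ev)
      decided e (inj₂ (¬h , ev)) =
        inj₂ ((λ H → ¬h (HaltsByF← e (bound e) (proj₁ (halting⇔HaltsBy-bound e) H))) , e-comp (args e) ev)


open Terms
open BoundedFormulas
open AncestorForest
open HaltingForest
open Decoding

-- The edge relation is the bounded formula itself, so that it is decidable by its code.
HaltingAdj : ℕ → ℕ → Set
HaltingAdj x y = holds AdjF (x ∷ y ∷ [])

HaltingAdj-sym : ∀ {x y} → HaltingAdj x y → HaltingAdj y x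
HaltingAdj-sym (inj₁ h) = inj₂ h
HaltingAdj-sym (inj₂ h) = inj₁ h

HaltingAdj-irrefl : ∀ {x} → ¬ HaltingAdj x x
HaltingAdj-irrefl {x} h with AdjF→ x x h
... | inj₁ anc = Ancestor-irrefl anc
... | inj₂ anc = Ancestor-irrefl anc

haltingGraph : Graph
haltingGraph = record { V = λ _ → ⊤ ; E = HaltingAdj ; E-sym = HaltingAdj-sym ; E-irr = HaltingAdj-irrefl ; E-V = λ _ → tt , tt }

haltingGraph-computable : ComputableGraph haltingGraph
haltingGraph-computable =
  (comp succ (zer ∷ []) , λ n → inj₁ (tt , e-comp (ev-∷ e-zer ev-[]) e-succ)) ,
  (let (c , spec) = decide noOracle AdjF in c , λ n m → spec (n ∷ m ∷ []))

consecutive-adjacent : ∀ i → Adj i (suc i)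
consecutive-adjacent i with Alive? i (suc i)
... | yes alive = inj₁ (inj₁ (≤-refl , alive))
... | no ¬alive = inj₂ (inj₂ (done (≤-refl , Alive-refl i , ¬alive)))

identity-tracing : Σ (ℕ → ℕ) λ T → IsTracing haltingGraph T × ComputableFun T
identity-tracing =
  id , ((λ _ → tt) , (λ _ _ e → e) , (λ v _ → v , refl) , (λ i → AdjF← i (suc i) (consecutive-adjacent i))) ,
  (proj zero , λ _ → e-proj)

no-chordless-4-path : ¬ ChordlessFourPath haltingGraph
no-chordless-4-path (v₀ , v₁ , v₂ , v₃ , _ , v₀≢v₂ , _ , _ , v₁≢v₃ , _ , e₀₁ , e₁₂ , e₂₃ , ¬e₀₂ , ¬e₁₃ , _) =
  no-induced-P4 v₀≢v₂ v₁≢v₃ (AdjF→ v₀ v₁ e₀₁) (AdjF→ v₁ v₂ e₁₂) (AdjF→ v₂ v₃ e₂₃)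
    (λ adj → ¬e₀₂ (AdjF← v₀ v₂ adj)) (λ adj → ¬e₁₃ (AdjF← v₁ v₃ adj))

halting-from-A : (g : Embedding Agraph haltingGraph) → ComputableFrom (emb g) Halting
halting-from-A g = FromEmbedding.halting-computable (emb g) (λ _ _ → emb-inj g tt tt)
  λ n m n≤m → AdjF→ (emb g (a n)) (emb g (b m)) (emb-E g (ab n m n≤m))

halting-from-Kωω : (g : Embedding Kωω haltingGraph) → ComputableFrom (emb g) Halting
halting-from-Kωω g = FromEmbedding.halting-computable (emb g) (λ _ _ → emb-inj g tt tt)
  λ n m _ → AdjF→ (emb g (a n)) (emb g (b m)) (emb-E g (ab n m))

corollary2p12 : Σ Graph λ G →
    ComputableGraph G ×
    (Σ (ℕ → ℕ) λ T → IsTracing G T × ComputableFun T) ×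
    ¬ ChordlessFourPath G ×
    (∀ (g : Embedding Agraph G) → ComputableFrom (emb g) Halting) ×
    (∀ (g : Embedding Kωω G) → ComputableFrom (emb g) Halting)
corollary2p12 =
  haltingGraph , haltingGraph-computable , identity-tracing , no-chordless-4-path , halting-from-A , halting-from-Kωω
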